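{- Let $A$ and $B$ be two subspaces of $\mathbb{Z}_{p^s}^n$. Then $$\dim(A\vee B)=\dim(A)+\dim(B)-\dim(A\cap B)=\rho\begin{pmatrix}A\\ B\end{pmatrix}.$$
   Context: $p$ is a prime, $s\ge1$, $R=\mathbb{Z}_{p^s}$; vectors are row vectors. A set $\{\alpha_1,\dots,\alpha_k\}\subseteq R^n$ is unimodular if the matrix with rows $\alpha_i$ has a right inverse over $R$. For a submodule (linear subset) $V\subseteq R^n$, $\dim(V)$ is the largest size of a unimodular subset of $V$. A $k$-subspace ($k\ge1$) is a submodule having a unimodular basis of $k$ vectors; the $0$-subspace is $\{0\}$. A subspace is identified with a matrix representation (a matrix whose rows form such a basis), and $\begin{pmatrix}A\\ B\end{pmatrix}$ is the matrix obtained by stacking representations of $A$ and $B$. The inner rank $\rho(M)$ of a nonzero matrix $M\in R^{a\times b}$ is the least $r$ such that $M=CD$ with $C\in R^{a\times r}$, $D\in R^{r\times b}$; $\rho(0)=0$. $A\cap B$ is the set-theoretic intersection (a linear subset, not necessarily a subspace). $A\vee B$ denotes the set of all subspaces of minimal dimension containing both $A$ and $B$ (joins), and $\dim(A\vee B)$ is that minimal dimension. -}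

module Defs where

open import Data.Nat using (ℕ; zero; suc; _+_; _*_; _≤_; NonZero)
open import Data.Nat.DivMod using (_mod_)
open import Data.Fin using (Fin; toℕ; _≟_)
open import Data.Vec using (Vec; lookup; tabulate; replicate)
open import Data.Product using (Σ; ∃; _×_)
open import Data.Bool using (if_then_else_)
open import Relation.Nullary.Decidable using (⌊_⌋)
open import Relation.Binary.PropositionalEquality using (_≡_)
open import Function.Bundles using (_⇔_)

-- The ring R = ℤ_q (q = p^s in the theorem), elements Fin q, arithmetic mod q.
R : ℕ → Set
R q = Fin q

module _ {q : ℕ} .{{_ : NonZero q}} where

  infixl 6 _+ᵣ_
  infixl 7 _*ᵣ_

  _+ᵣ_ : R q → R q → R q
  a +ᵣ b = (toℕ a + toℕ b) mod q

  _*ᵣ_ : R q → R q → R q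
  a *ᵣ b = (toℕ a * toℕ b) mod q

  0ᵣ 1ᵣ : R q
  0ᵣ = 0 mod q
  1ᵣ = 1 mod q

  Σᵣ : {k : ℕ} → (Fin k → R q) → R q
  Σᵣ {zero} f = 0ᵣ
  Σᵣ {suc k} f = f Fin.zero +ᵣ Σᵣ (λ i → f (Fin.suc i))

RVec : ℕ → ℕ → Set
RVec q n = Vec (R q) n

Mat : ℕ → ℕ → ℕ → Set
Mat q a b = Vec (Vec (R q) b) a

Subset : ℕ → ℕ → Set₁
Subset q n = RVec q n → Set

module _ {q : ℕ} .{{_ : NonZero q}} where

  zeroVec : {n : ℕ} → RVec q n
  zeroVec = replicate _ 0ᵣ

  _⊗_ : {a b c : ℕ} → Mat q a b → Mat q b c → Mat q a c
  M ⊗ N = tabulate λ i → tabulate λ j → Σᵣ λ l → lookup (lookup M i) l *ᵣ lookup (lookup N l) j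

  idMat : {k : ℕ} → Mat q k k
  idMat = tabulate λ i → tabulate λ j → if ⌊ i ≟ j ⌋ then 1ᵣ else 0ᵣ

  -- the family of rows of M is unimodular: M has a right inverse over R
  Unimodular : {k n : ℕ} → Mat q k n → Set
  Unimodular {k} {n} M = Σ (Mat q n k) λ N → M ⊗ N ≡ idMat

  comb : {k n : ℕ} → RVec q k → Mat q k n → RVec q n
  comb c M = tabulate λ j → Σᵣ λ i → lookup c i *ᵣ lookup (lookup M i) j

  _+ᵥ_ : {n : ℕ} → RVec q n → RVec q n → RVec q n
  u +ᵥ v = tabulate λ j → lookup u j +ᵣ lookup v j

  _·ᵥ_ : {n : ℕ} → R q → RVec q n → RVec q n
  r ·ᵥ v = tabulate λ j → r *ᵣ lookup v j

  IsLinear : {n : ℕ} → Subset q n → Set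
  IsLinear V = V zeroVec
             × (∀ u v → V u → V v → V (u +ᵥ v))
             × (∀ r v → V v → V (r ·ᵥ v))

  _⊆_ : {n : ℕ} → Subset q n → Subset q n → Set
  A ⊆ B = ∀ v → A v → B v

  _∩_ : {n : ℕ} → Subset q n → Subset q n → Subset q n
  (A ∩ B) v = A v × B v

  AllRowsIn : {k n : ℕ} → Mat q k n → Subset q n → Set
  AllRowsIn M V = ∀ i → V (lookup M i)

  RowSpan : {k n : ℕ} → Mat q k n → Subset q n
  RowSpan M v = ∃ λ c → v ≡ comb c M

  HasDim : {n : ℕ} → Subset q n → ℕ → Set
  HasDim {n} V d =
      (Σ (Mat q d n) λ M → Unimodular M × AllRowsIn M V)
    × (∀ k (M : Mat q k n) → Unimodular M → AllRowsIn M V → k ≤ d)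

  IsBasis : {k n : ℕ} → Mat q k n → Subset q n → Set
  IsBasis M V = (∀ v → V v ⇔ RowSpan M v)
              × (∀ c → comb c M ≡ zeroVec → c ≡ zeroVec)

  -- V is a k-subspace: a submodule with a unimodular basis of k vectors
  -- (for k = 0 this is exactly the 0-subspace {0})
  IsSubspace : {n : ℕ} → ℕ → Subset q n → Set
  IsSubspace {n} k V = IsLinear V × Σ (Mat q k n) λ M → Unimodular M × IsBasis M V

  JoinDim : {n : ℕ} → Subset q n → Subset q n → ℕ → Set₁
  JoinDim {n} A B d =
      (Σ (Subset q n) λ V → IsSubspace d V × A ⊆ V × B ⊆ V)
    × (∀ k (V : Subset q n) → IsSubspace k V → A ⊆ V → B ⊆ V → d ≤ k)

  HasInnerRank : {a b : ℕ} → Mat q a b → ℕ → Set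
  HasInnerRank {a} {b} M r =
      (Σ (Mat q a r) λ C → Σ (Mat q r b) λ D → C ⊗ D ≡ M)
    × (∀ r' (C : Mat q a r') (D : Mat q r' b) → C ⊗ D ≡ M → r ≤ r')

-- Over ℤ/p^s divisibility is a total preorder and every nonzero element divides the socle
-- element p^(s-1). Hence every matrix X has a diagonal form P X Q = diag(d₁,…,d_r,0,…) with
-- P, Q invertible and all dᵢ ≠ 0. For X = (A over B), the first r rows of Q⁻¹ form a unimodular
-- basis of a subspace containing A and B, and the last a+b−r rows of P, split as (U | W) with
-- U A = −W B, give a unimodular family U A inside A ∩ B. Every matching upper bound reduces to
-- one fact: if socle · I_k factors through k′ columns then k ≤ k′. Rescaling the rows that meet
-- d₁,…,d_r by multipliers sending each dᵢ to the socle turns a factorisation of X through r′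
-- columns, a basis of a subspace containing A and B, or a unimodular family in A ∩ B (which
-- annihilates X from the left) into such a factorisation. So dim(A ∨ B) = r = ρ(A over B) and
-- dim(A ∩ B) = a + b − r.
module Submission where

open import Algebra.Bundles using (CommutativeRing)
open import Algebra.Core using (Op₁; Op₂)
import Algebra.Definitions.RawMagma as RawMagma
open import Algebra.Structures using (IsCommutativeRing)
open import Data.Nat using (ℕ; _≤_; _^_; NonZero)
open import Data.Nat.Primality using (Prime)
open import Data.Sum using (_⊎_)
open import Level using (0ℓ)
open import Relation.Binary.Definitions using (DecidableEquality)
open import Relation.Binary.PropositionalEquality using (_≡_; _≢_)

record ChainRing : Set₁ where
  infixl 6 _+_
  infixl 7 _*_
  infix 8 -_
  field
    Carrier : Set
    _+_ _*_ : Op₂ Carrier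
    -_ : Op₁ Carrier
    0# 1# : Carrier
    isCommutativeRing : IsCommutativeRing _≡_ _+_ _*_ -_ 0# 1#
    _≟_ : DecidableEquality Carrier

  commutativeRing : CommutativeRing 0ℓ 0ℓ
  commutativeRing = record { isCommutativeRing = isCommutativeRing }

  open CommutativeRing commutativeRing public
    hiding (Carrier; _+_; _*_; -_; 0#; 1#; isCommutativeRing)
  open RawMagma *-rawMagma public using (_∣_; module _∣ʳ_)

  field
    ∣-total : ∀ x y → x ∣ y ⊎ y ∣ x
    socle : Carrier
    socle≢0 : socle ≢ 0#
    ∣socle : ∀ {x} → x ≢ 0# → x ∣ socle

module Matrices {c ℓ} (R : CommutativeRing c ℓ) where
  open import Data.Bool using (if_then_else_)
  import Data.Fin.Properties as Fin
  open import Data.Fin as Fin using (Fin; zero; suc; toℕ; _↑ˡ_; _↑ʳ_; inject≤)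
  open import Data.Empty using (⊥-elim)
  open import Data.Nat as ℕ using (ℕ; _∸_; _≤_; z≤n; s≤s)
  open import Data.Product using (Σ; _×_; _,_)
  open import Level using (_⊔_)
  open import Function using (_∘_)
  open import Relation.Binary.Bundles using (Setoid)
  open import Relation.Nullary.Decidable using (does)
  open import Relation.Nullary using (yes; no)
  import Relation.Binary.Reasoning.Setoid as SetoidReasoning
  open import Relation.Binary.PropositionalEquality as ≡ using (_≡_; _≢_)
  open import Data.Vec.Functional using (_++_)
  import Data.Vec.Functional.Properties as Vector

  open CommutativeRing R hiding (zero)
  open import Algebra.Properties.Semiring.Sum semiring public
    using (sum; sum-cong-≋; *-distribˡ-sum)
  open import Algebra.Properties.Semiring.Sum semiring
    using (∑-comm; ∑-distrib-+; *-distribʳ-sum; sum-replicate-zero)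
  open import Algebra.Properties.CommutativeSemigroup *-commutativeSemigroup using (x∙yz≈y∙xz)
  open import Algebra.Properties.Ring ring using (-‿distribˡ-*; -‿distribʳ-*; -1*x≈-x; -‿involutive)

  private variable k l m n : ℕ

  ∑-zero : {f : Fin n → Carrier} → (∀ i → f i ≈ 0#) → sum f ≈ 0#
  ∑-zero {n} f≈0 = trans (sum-cong-≋ f≈0) (sum-replicate-zero n)

  ∑-↑ : (f : Fin (m ℕ.+ n) → Carrier) → sum f ≈ sum (f ∘ (_↑ˡ n)) + sum (f ∘ (m ↑ʳ_))
  ∑-↑ {ℕ.zero} f = sym (+-identityˡ _)
  ∑-↑ {ℕ.suc m} {n} f = trans (+-congˡ (∑-↑ {m} {n} (f ∘ suc))) (sym (+-assoc _ _ _))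

  raise≤ : ∀ {r m} → r ≤ m → Fin (m ∸ r) → Fin m
  raise≤ z≤n i = i
  raise≤ (s≤s r≤m) i = suc (raise≤ r≤m i)

  toℕ-raise≤ : ∀ {r m} (r≤m : r ≤ m) i → toℕ (raise≤ r≤m i) ≡ r ℕ.+ toℕ i
  toℕ-raise≤ z≤n i = ≡.refl
  toℕ-raise≤ (s≤s r≤m) i = ≡.cong ℕ.suc (toℕ-raise≤ r≤m i)

  raise≤-injective : ∀ {r m} (r≤m : r ≤ m) {i j} → raise≤ r≤m i ≡ raise≤ r≤m j → i ≡ j
  raise≤-injective z≤n eq = eq
  raise≤-injective (s≤s r≤m) eq = raise≤-injective r≤m (Fin.suc-injective eq)

  ∑-inject≤-raise≤ : ∀ {r m} (r≤m : r ≤ m) (f : Fin m → Carrier) →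
                     sum f ≈ sum (f ∘ λ i → inject≤ i r≤m) + sum (f ∘ raise≤ r≤m)
  ∑-inject≤-raise≤ z≤n f = sym (+-identityˡ _)
  ∑-inject≤-raise≤ (s≤s r≤m) f = trans (+-congˡ (∑-inject≤-raise≤ r≤m (f ∘ suc))) (sym (+-assoc _ _ _))

  Matrix : ℕ → ℕ → Set c
  Matrix m n = Fin m → Fin n → Carrier

  infix 4 _≈ₘ_
  _≈ₘ_ : Matrix m n → Matrix m n → Set ℓ
  X ≈ₘ Y = ∀ i j → X i j ≈ Y i j

  ≈ₘ-setoid : ℕ → ℕ → Setoid c ℓ
  ≈ₘ-setoid m n = record
    { Carrier = Matrix m n
    ; _≈_ = _≈ₘ_
    ; isEquivalence = record
      { refl = λ i j → refl
      ; sym = λ X≈Y i j → sym (X≈Y i j)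
      ; trans = λ X≈Y Y≈Z i j → trans (X≈Y i j) (Y≈Z i j) } }

  module ≈ₘ-Reasoning {m n} = SetoidReasoning (≈ₘ-setoid m n)

  ≈ₘ-refl : {X : Matrix m n} → X ≈ₘ X
  ≈ₘ-refl = Setoid.refl (≈ₘ-setoid _ _)

  ≈ₘ-sym : {X Y : Matrix m n} → X ≈ₘ Y → Y ≈ₘ X
  ≈ₘ-sym = Setoid.sym (≈ₘ-setoid _ _)

  ≈ₘ-trans : {X Y Z : Matrix m n} → X ≈ₘ Y → Y ≈ₘ Z → X ≈ₘ Z
  ≈ₘ-trans = Setoid.trans (≈ₘ-setoid _ _)

  infixl 7 _⊙_
  _⊙_ : Matrix m k → Matrix k n → Matrix m n
  (X ⊙ Y) i j = sum λ l → X i l * Y l j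

  infixl 6 _⊞_
  _⊞_ : Matrix m n → Matrix m n → Matrix m n
  (X ⊞ Y) i j = X i j + Y i j

  ⊟_ : Matrix m n → Matrix m n
  (⊟ X) i j = - X i j

  O : Matrix m n
  O _ _ = 0#

  δ : Fin n → Fin n → Carrier
  δ i j = if does (i Fin.≟ j) then 1# else 0#

  I : Matrix n n
  I = δ

  δ-refl : (i : Fin n) → δ i i ≡ 1#
  δ-refl zero = ≡.refl
  δ-refl (suc i) = δ-refl i

  δ-≢ : {i j : Fin n} → i ≢ j → δ i j ≡ 0#
  δ-≢ {i = zero} {zero} i≢j = ⊥-elim (i≢j ≡.refl)
  δ-≢ {i = zero} {suc j} _ = ≡.refl
  δ-≢ {i = suc i} {zero} _ = ≡.refl
  δ-≢ {i = suc i} {suc j} i≢j = δ-≢ (i≢j ∘ ≡.cong suc)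

  δ-injective : ∀ {k} {f : Fin k → Fin n} → (∀ {i j} → f i ≡ f j → i ≡ j) → ∀ i j → δ (f i) (f j) ≡ δ i j
  δ-injective {f = f} f-injective i j with i Fin.≟ j
  ... | yes ≡.refl = δ-refl (f i)
  ... | no i≢j = δ-≢ (i≢j ∘ f-injective)

  ∑-δˡ : (i : Fin n) (f : Fin n → Carrier) → sum (λ l → δ i l * f l) ≈ f i
  ∑-δˡ zero f = trans (+-cong (*-identityˡ (f zero)) (∑-zero λ l → zeroˡ (f (suc l)))) (+-identityʳ (f zero))
  ∑-δˡ (suc i) f = trans (+-cong (zeroˡ (f zero)) (∑-δˡ i (f ∘ suc))) (+-identityˡ (f (suc i)))

  ∑-single : (l₀ : Fin n) (f : Fin n → Carrier) → (∀ l → l ≢ l₀ → f l ≈ 0#) → sum f ≈ f l₀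
  ∑-single l₀ f f≈0 = trans (sum-cong-≋ δf≈f) (∑-δˡ l₀ f)
    where
      δf≈f : ∀ l → f l ≈ δ l₀ l * f l
      δf≈f l with l Fin.≟ l₀
      ... | yes ≡.refl = sym (trans (*-congʳ (reflexive (δ-refl l))) (*-identityˡ (f l)))
      ... | no l≢l₀ = trans (f≈0 l l≢l₀) (sym (trans (*-congʳ (reflexive (δ-≢ (l≢l₀ ∘ ≡.sym)))) (zeroˡ (f l))))

  ∑-δʳ : (j : Fin n) (f : Fin n → Carrier) → sum (λ l → f l * δ l j) ≈ f j
  ∑-δʳ zero f = trans (+-cong (*-identityʳ (f zero)) (∑-zero λ l → zeroʳ (f (suc l)))) (+-identityʳ (f zero))
  ∑-δʳ (suc j) f = trans (+-cong (zeroʳ (f zero)) (∑-δʳ j (f ∘ suc))) (+-identityˡ (f (suc j)))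

  ⊙-cong : {X X′ : Matrix m k} {Y Y′ : Matrix k n} → X ≈ₘ X′ → Y ≈ₘ Y′ → X ⊙ Y ≈ₘ X′ ⊙ Y′
  ⊙-cong X≈X′ Y≈Y′ i j = sum-cong-≋ λ l → *-cong (X≈X′ i l) (Y≈Y′ l j)

  ⊙-congˡ : (X : Matrix m k) {Y Y′ : Matrix k n} → Y ≈ₘ Y′ → X ⊙ Y ≈ₘ X ⊙ Y′
  ⊙-congˡ X = ⊙-cong {X = X} ≈ₘ-refl

  ⊙-congʳ : {X X′ : Matrix m k} (Y : Matrix k n) → X ≈ₘ X′ → X ⊙ Y ≈ₘ X′ ⊙ Y
  ⊙-congʳ Y X≈X′ = ⊙-cong {Y = Y} X≈X′ ≈ₘ-refl

  ⊙-assoc : (X : Matrix m k) (Y : Matrix k l) (Z : Matrix l n) → (X ⊙ Y) ⊙ Z ≈ₘ X ⊙ (Y ⊙ Z)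
  ⊙-assoc X Y Z i j = begin
    sum (λ b → sum (λ a → X i a * Y a b) * Z b j)
      ≈⟨ sum-cong-≋ (λ b → *-distribʳ-sum (Z b j) (λ a → X i a * Y a b)) ⟩
    sum (λ b → sum (λ a → X i a * Y a b * Z b j))
      ≈⟨ ∑-comm (λ b a → X i a * Y a b * Z b j) ⟩
    sum (λ a → sum (λ b → X i a * Y a b * Z b j))
      ≈⟨ sum-cong-≋ (λ a → sum-cong-≋ λ b → *-assoc (X i a) (Y a b) (Z b j)) ⟩
    sum (λ a → sum (λ b → X i a * (Y a b * Z b j)))
      ≈⟨ sum-cong-≋ (λ a → *-distribˡ-sum (X i a) (λ b → Y a b * Z b j)) ⟨
    sum (λ a → X i a * sum (λ b → Y a b * Z b j))
      ∎
    where open SetoidReasoning setoid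

  ⊙-identityˡ : (X : Matrix m n) → I ⊙ X ≈ₘ X
  ⊙-identityˡ X i j = ∑-δˡ i (λ l → X l j)

  ⊙-identityʳ : (X : Matrix m n) → X ⊙ I ≈ₘ X
  ⊙-identityʳ X i j = ∑-δʳ j (X i)

  ⊙-zeroˡ : (X : Matrix k n) → O {m} ⊙ X ≈ₘ O
  ⊙-zeroˡ X i j = ∑-zero λ l → zeroˡ (X l j)

  ⊙-distribˡ-⊞ : (X : Matrix m k) (Y Z : Matrix k n) → X ⊙ (Y ⊞ Z) ≈ₘ X ⊙ Y ⊞ X ⊙ Z
  ⊙-distribˡ-⊞ X Y Z i j =
    trans (sum-cong-≋ λ l → distribˡ (X i l) (Y l j) (Z l j)) (∑-distrib-+ (λ l → X i l * Y l j) (λ l → X i l * Z l j))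

  ⊙-distribʳ-⊞ : (X Y : Matrix m k) (Z : Matrix k n) → (X ⊞ Y) ⊙ Z ≈ₘ X ⊙ Z ⊞ Y ⊙ Z
  ⊙-distribʳ-⊞ X Y Z i j =
    trans (sum-cong-≋ λ l → distribʳ (Z l j) (X i l) (Y i l)) (∑-distrib-+ (λ l → X i l * Z l j) (λ l → Y i l * Z l j))

  ⊟-distribˡ-⊙ : (X : Matrix m k) (Y : Matrix k n) → ⊟ (X ⊙ Y) ≈ₘ (⊟ X) ⊙ Y
  ⊟-distribˡ-⊙ X Y i j = begin
    - sum (λ l → X i l * Y l j)        ≈⟨ -1*x≈-x (sum λ l → X i l * Y l j) ⟨
    - 1# * sum (λ l → X i l * Y l j)   ≈⟨ *-distribˡ-sum (- 1#) (λ l → X i l * Y l j) ⟩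
    sum (λ l → - 1# * (X i l * Y l j)) ≈⟨ sum-cong-≋ (λ l → trans (-1*x≈-x _) (-‿distribˡ-* (X i l) (Y l j))) ⟩
    sum (λ l → - X i l * Y l j)        ∎
    where open SetoidReasoning setoid

  ⊟-distribʳ-⊙ : (X : Matrix m k) (Y : Matrix k n) → ⊟ (X ⊙ Y) ≈ₘ X ⊙ (⊟ Y)
  ⊟-distribʳ-⊙ X Y i j = begin
    - sum (λ l → X i l * Y l j)        ≈⟨ -1*x≈-x (sum λ l → X i l * Y l j) ⟨
    - 1# * sum (λ l → X i l * Y l j)   ≈⟨ *-distribˡ-sum (- 1#) (λ l → X i l * Y l j) ⟩
    sum (λ l → - 1# * (X i l * Y l j)) ≈⟨ sum-cong-≋ (λ l → trans (-1*x≈-x _) (-‿distribʳ-* (X i l) (Y l j))) ⟩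
    sum (λ l → X i l * - Y l j)        ∎
    where open SetoidReasoning setoid

  infixr 8 _⋆_
  _⋆_ : Carrier → Matrix m n → Matrix m n
  (s ⋆ X) i j = s * X i j

  ⋆-⊙ : (s : Carrier) (X : Matrix m k) (Y : Matrix k n) → (s ⋆ X) ⊙ Y ≈ₘ s ⋆ (X ⊙ Y)
  ⋆-⊙ s X Y i j = trans (sum-cong-≋ λ l → *-assoc s (X i l) (Y l j)) (sym (*-distribˡ-sum s (λ l → X i l * Y l j)))

  ⊙-⋆ : (s : Carrier) (X : Matrix m k) (Y : Matrix k n) → X ⊙ (s ⋆ Y) ≈ₘ s ⋆ (X ⊙ Y)
  ⊙-⋆ s X Y i j = trans (sum-cong-≋ λ l → x∙yz≈y∙xz (X i l) s (Y l j)) (sym (*-distribˡ-sum s (λ l → X i l * Y l j)))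

  Inverse : Matrix n n → Matrix n n → Set ℓ
  Inverse P P⁻¹ = P ⊙ P⁻¹ ≈ₘ I × P⁻¹ ⊙ P ≈ₘ I

  ⊙-cancel : {P : Matrix k l} {P⁻¹ : Matrix l k} (X : Matrix m k) (Y : Matrix k n) → P ⊙ P⁻¹ ≈ₘ I →
             X ⊙ P ⊙ (P⁻¹ ⊙ Y) ≈ₘ X ⊙ Y
  ⊙-cancel {P = P} {P⁻¹} X Y PP⁻¹≈I = begin
    X ⊙ P ⊙ (P⁻¹ ⊙ Y)   ≈⟨ ⊙-assoc X P (P⁻¹ ⊙ Y) ⟩
    X ⊙ (P ⊙ (P⁻¹ ⊙ Y)) ≈⟨ ⊙-congˡ X (≈ₘ-sym (⊙-assoc P P⁻¹ Y)) ⟩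
    X ⊙ (P ⊙ P⁻¹ ⊙ Y)   ≈⟨ ⊙-congˡ X (⊙-congʳ Y PP⁻¹≈I) ⟩
    X ⊙ (I ⊙ Y)         ≈⟨ ⊙-congˡ X (⊙-identityˡ Y) ⟩
    X ⊙ Y               ∎
    where open ≈ₘ-Reasoning

  inverse-⊙ : {P P⁻¹ Q Q⁻¹ : Matrix n n} → Inverse P P⁻¹ → Inverse Q Q⁻¹ → Inverse (P ⊙ Q) (Q⁻¹ ⊙ P⁻¹)
  inverse-⊙ {P = P} {P⁻¹} {Q} {Q⁻¹} (PP⁻¹ , P⁻¹P) (QQ⁻¹ , Q⁻¹Q) =
    ≈ₘ-trans (⊙-cancel {P = Q} {Q⁻¹} P P⁻¹ QQ⁻¹) PP⁻¹ , ≈ₘ-trans (⊙-cancel {P = P⁻¹} {P} Q⁻¹ Q P⁻¹P) Q⁻¹Q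

  infix 5 _⊕_
  _⊕_ : Carrier → Matrix m n → Matrix (ℕ.suc m) (ℕ.suc n)
  (d ⊕ X) zero    zero    = d
  (d ⊕ X) zero    (suc j) = 0#
  (d ⊕ X) (suc i) zero    = 0#
  (d ⊕ X) (suc i) (suc j) = X i j

  ⊕-cong : {d d′ : Carrier} {X X′ : Matrix m n} → d ≈ d′ → X ≈ₘ X′ → d ⊕ X ≈ₘ d′ ⊕ X′
  ⊕-cong d≈d′ X≈X′ zero    zero    = d≈d′
  ⊕-cong d≈d′ X≈X′ zero    (suc j) = refl
  ⊕-cong d≈d′ X≈X′ (suc i) zero    = refl
  ⊕-cong d≈d′ X≈X′ (suc i) (suc j) = X≈X′ i j

  ⊕-⊙ : (a b : Carrier) (X : Matrix m k) (Y : Matrix k n) → (a ⊕ X) ⊙ (b ⊕ Y) ≈ₘ (a * b) ⊕ (X ⊙ Y)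
  ⊕-⊙ {k = k} a b X Y zero zero = trans (+-congˡ (∑-zero {k} λ l → zeroˡ 0#)) (+-identityʳ (a * b))
  ⊕-⊙ {k = k} a b X Y zero (suc j) = trans (+-cong (zeroʳ a) (∑-zero {k} λ l → zeroˡ (Y l j))) (+-identityʳ 0#)
  ⊕-⊙ {k = k} a b X Y (suc i) zero = trans (+-cong (zeroˡ b) (∑-zero {k} λ l → zeroʳ (X i l))) (+-identityʳ 0#)
  ⊕-⊙ a b X Y (suc i) (suc j) = trans (+-congʳ (zeroˡ 0#)) (+-identityˡ _)

  1⊕I : 1# ⊕ I {n} ≈ₘ I
  1⊕I zero    zero    = refl
  1⊕I zero    (suc j) = refl
  1⊕I (suc i) zero    = refl
  1⊕I (suc i) (suc j) = refl

  inverse-⊕ : {P P⁻¹ : Matrix n n} → Inverse P P⁻¹ → Inverse (1# ⊕ P) (1# ⊕ P⁻¹)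
  inverse-⊕ {P = P} {P⁻¹} (PP⁻¹ , P⁻¹P) = block PP⁻¹ , block P⁻¹P
    where
      block : ∀ {X Y : Matrix _ _} → X ⊙ Y ≈ₘ I → (1# ⊕ X) ⊙ (1# ⊕ Y) ≈ₘ I
      block {X} {Y} XY≈I = ≈ₘ-trans (⊕-⊙ 1# 1# X Y) (≈ₘ-trans (⊕-cong (*-identityˡ 1#) XY≈I) 1⊕I)

  infix 10 _ᵀ
  _ᵀ : Matrix m n → Matrix n m
  (X ᵀ) i j = X j i

  δ-sym : (i j : Fin n) → δ i j ≡ δ j i
  δ-sym zero    zero    = ≡.refl
  δ-sym zero    (suc j) = ≡.refl
  δ-sym (suc i) zero    = ≡.refl
  δ-sym (suc i) (suc j) = δ-sym i j

  ᵀ-⊙ : (X : Matrix m k) (Y : Matrix k n) → (X ⊙ Y) ᵀ ≈ₘ Y ᵀ ⊙ X ᵀ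
  ᵀ-⊙ X Y i j = sum-cong-≋ λ l → *-comm (X j l) (Y l i)

  ᵀ-cong : {X Y : Matrix m n} → X ≈ₘ Y → X ᵀ ≈ₘ Y ᵀ
  ᵀ-cong X≈Y i j = X≈Y j i

  ⊙≈I⇒ᵀ⊙ᵀ≈I : (X : Matrix m n) (Y : Matrix n m) → X ⊙ Y ≈ₘ I → Y ᵀ ⊙ X ᵀ ≈ₘ I
  ⊙≈I⇒ᵀ⊙ᵀ≈I X Y XY≈I i j =
    trans (sym (ᵀ-⊙ X Y i j)) (trans (XY≈I j i) (reflexive (δ-sym j i)))

  ⋆-cong : (s : Carrier) {X Y : Matrix m n} → X ≈ₘ Y → s ⋆ X ≈ₘ s ⋆ Y
  ⋆-cong s X≈Y i j = *-congˡ (X≈Y i j)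

  ⋆-I : (s : Carrier) (i : Fin n) → (s ⋆ I) i i ≈ s
  ⋆-I s i = trans (*-congˡ (reflexive (δ-refl i))) (*-identityʳ s)

  ⊙-zero-row : (X : Matrix m k) (Y : Matrix k n) {i : Fin m} → (∀ l → X i l ≈ 0#) → ∀ j → (X ⊙ Y) i j ≈ 0#
  ⊙-zero-row X Y X[i]≈0 j = ∑-zero λ l → trans (*-congʳ (X[i]≈0 l)) (zeroˡ (Y l j))

  HasRightInverse : Matrix m n → Set (c ⊔ ℓ)
  HasRightInverse {m} {n} X = Σ (Matrix n m) λ N → X ⊙ N ≈ₘ I

  ⊙-split : ∀ {a b} (Y : Matrix k (a ℕ.+ b)) (Z : Matrix (a ℕ.+ b) n) →
            Y ⊙ Z ≈ₘ (λ i x → Y i (x ↑ˡ b)) ⊙ (λ x → Z (x ↑ˡ b))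
                   ⊞ (λ i x → Y i (a ↑ʳ x)) ⊙ (λ x → Z (a ↑ʳ x))
  ⊙-split {a = a} {b} Y Z i j = ∑-↑ {a} {b} λ l → Y i l * Z l j

  ++-⊙-++ : ∀ {a b} (C : Matrix k a) (E : Matrix k b) (X : Matrix a n) (Y : Matrix b n) →
            (λ i → C i ++ E i) ⊙ (X ++ Y) ≈ₘ C ⊙ X ⊞ E ⊙ Y
  ++-⊙-++ {a = a} {b} C E X Y i j = trans (⊙-split {a = a} {b} (λ i → C i ++ E i) (X ++ Y) i j)
    (+-cong (⊙-cong (λ i l → reflexive (Vector.lookup-++ˡ (C i) (E i) l))
                    (λ l → reflexive ∘ ≡.cong-app (Vector.lookup-++ˡ X Y l)) i j)
            (⊙-cong (λ i l → reflexive (Vector.lookup-++ʳ (C i) (E i) l))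
                    (λ l → reflexive ∘ ≡.cong-app (Vector.lookup-++ʳ X Y l)) i j))

  ⊙-zeroʳ : (X : Matrix m k) → X ⊙ O {k} {n} ≈ₘ O
  ⊙-zeroʳ X i j = ∑-zero λ l → zeroʳ (X i l)

  ⊞-cong : {X X′ Y Y′ : Matrix m n} → X ≈ₘ X′ → Y ≈ₘ Y′ → X ⊞ Y ≈ₘ X′ ⊞ Y′
  ⊞-cong X≈X′ Y≈Y′ i j = +-cong (X≈X′ i j) (Y≈Y′ i j)

  ⊟-cong : {X Y : Matrix m n} → X ≈ₘ Y → ⊟ X ≈ₘ ⊟ Y
  ⊟-cong X≈Y i j = -‿cong (X≈Y i j)

  ⊟-involutive : (X : Matrix m n) → ⊟ ⊟ X ≈ₘ X
  ⊟-involutive X i j = -‿involutive (X i j)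

module SmithNormalForm (R : ChainRing) where
  open import Data.Fin as Fin using (Fin; zero; suc; toℕ)
  open import Data.Fin.Permutation as Perm using (Permutation′; _⟨$⟩ʳ_; _⟨$⟩ˡ_; inverseˡ; inverseʳ)
  open import Data.Nat as ℕ using (ℕ; _≤_; z≤n; s≤s)
  open import Data.Product using (Σ; ∃₂; _,_; proj₁; proj₂)
  open import Data.Empty using (⊥-elim)
  open import Data.Sum using (inj₁; inj₂)
  open import Function using (_∘_)
  open import Relation.Nullary using (yes; no)
  import Relation.Binary.PropositionalEquality as ≡
  open import Relation.Binary.PropositionalEquality using (_≡_; _≢_; cong; module ≡-Reasoning)

  open ChainRing R hiding (zero)
  open Matrices commutativeRing
  open import Algebra.Properties.Monoid.Divisibility *-monoid using (∣ʳ-refl)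
  open import Algebra.Properties.Semigroup.Divisibility *-semigroup using (∣ʳ-trans)
  open import Algebra.Properties.Ring ring using (-‿distribˡ-*)

  private variable m n : ℕ

  infix 4 _∼_
  record _∼_ (X Y : Matrix m n) : Set where
    field
      P P⁻¹ : Matrix m m
      Q Q⁻¹ : Matrix n n
      P-inverse : Inverse P P⁻¹
      Q-inverse : Inverse Q Q⁻¹
      transform : P ⊙ X ⊙ Q ≈ₘ Y

  ∼-reflexive : {X Y : Matrix m n} → X ≈ₘ Y → X ∼ Y
  ∼-reflexive {X = X} X≈Y = record
    { P = I ; P⁻¹ = I ; Q = I ; Q⁻¹ = I
    ; P-inverse = ⊙-identityˡ I , ⊙-identityˡ I
    ; Q-inverse = ⊙-identityˡ I , ⊙-identityˡ I
    ; transform = ≈ₘ-trans (⊙-identityʳ (I ⊙ X)) (≈ₘ-trans (⊙-identityˡ X) X≈Y) }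

  ∼-trans : {X Y Z : Matrix m n} → X ∼ Y → Y ∼ Z → X ∼ Z
  ∼-trans {X = X} {Y} {Z} X∼Y Y∼Z = record
    { P = B.P ⊙ A.P ; P⁻¹ = A.P⁻¹ ⊙ B.P⁻¹ ; Q = A.Q ⊙ B.Q ; Q⁻¹ = B.Q⁻¹ ⊙ A.Q⁻¹
    ; P-inverse = inverse-⊙ B.P-inverse A.P-inverse
    ; Q-inverse = inverse-⊙ A.Q-inverse B.Q-inverse
    ; transform = begin
        B.P ⊙ A.P ⊙ X ⊙ (A.Q ⊙ B.Q)     ≈⟨ ⊙-assoc (B.P ⊙ A.P ⊙ X) A.Q B.Q ⟨
        B.P ⊙ A.P ⊙ X ⊙ A.Q ⊙ B.Q       ≈⟨ ⊙-congʳ B.Q (⊙-congʳ A.Q (⊙-assoc B.P A.P X)) ⟩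
        B.P ⊙ (A.P ⊙ X) ⊙ A.Q ⊙ B.Q     ≈⟨ ⊙-congʳ B.Q (⊙-assoc B.P (A.P ⊙ X) A.Q) ⟩
        B.P ⊙ (A.P ⊙ X ⊙ A.Q) ⊙ B.Q     ≈⟨ ⊙-congʳ B.Q (⊙-congˡ B.P A.transform) ⟩
        B.P ⊙ Y ⊙ B.Q                   ≈⟨ B.transform ⟩
        Z                               ∎ }
    where
      module A = _∼_ X∼Y
      module B = _∼_ Y∼Z
      open ≈ₘ-Reasoning

  ∼-⊕ : (d : Carrier) {X Y : Matrix m n} → X ∼ Y → d ⊕ X ∼ d ⊕ Y
  ∼-⊕ d {X} {Y} X∼Y = record
    { P = 1# ⊕ P ; P⁻¹ = 1# ⊕ P⁻¹ ; Q = 1# ⊕ Q ; Q⁻¹ = 1# ⊕ Q⁻¹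
    ; P-inverse = inverse-⊕ P-inverse
    ; Q-inverse = inverse-⊕ Q-inverse
    ; transform = begin
        (1# ⊕ P) ⊙ (d ⊕ X) ⊙ (1# ⊕ Q)  ≈⟨ ⊙-congʳ (1# ⊕ Q) (⊕-⊙ 1# d P X) ⟩
        (1# * d ⊕ P ⊙ X) ⊙ (1# ⊕ Q)    ≈⟨ ⊕-⊙ (1# * d) 1# (P ⊙ X) Q ⟩
        (1# * d * 1# ⊕ P ⊙ X ⊙ Q)      ≈⟨ ⊕-cong (trans (*-identityʳ (1# * d)) (*-identityˡ d)) transform ⟩
        d ⊕ Y                          ∎ }
    where
      open _∼_ X∼Y
      open ≈ₘ-Reasoning

  ∼-ᵀ : {X Y : Matrix m n} → X ∼ Y → X ᵀ ∼ Y ᵀ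
  ∼-ᵀ {X = X} {Y} X∼Y = record
    { P = Q ᵀ ; P⁻¹ = Q⁻¹ ᵀ ; Q = P ᵀ ; Q⁻¹ = P⁻¹ ᵀ
    ; P-inverse = ⊙≈I⇒ᵀ⊙ᵀ≈I Q⁻¹ Q (proj₂ Q-inverse) , ⊙≈I⇒ᵀ⊙ᵀ≈I Q Q⁻¹ (proj₁ Q-inverse)
    ; Q-inverse = ⊙≈I⇒ᵀ⊙ᵀ≈I P⁻¹ P (proj₂ P-inverse) , ⊙≈I⇒ᵀ⊙ᵀ≈I P P⁻¹ (proj₁ P-inverse)
    ; transform = begin
        Q ᵀ ⊙ X ᵀ ⊙ P ᵀ   ≈⟨ ⊙-congʳ (P ᵀ) (ᵀ-⊙ X Q) ⟨
        (X ⊙ Q) ᵀ ⊙ P ᵀ   ≈⟨ ᵀ-⊙ P (X ⊙ Q) ⟨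
        (P ⊙ (X ⊙ Q)) ᵀ   ≈⟨ ᵀ-cong (⊙-assoc P X Q) ⟨
        (P ⊙ X ⊙ Q) ᵀ     ≈⟨ ᵀ-cong transform ⟩
        Y ᵀ               ∎ }
    where
      open _∼_ X∼Y
      open ≈ₘ-Reasoning

  permutationMatrix : Permutation′ n → Matrix n n
  permutationMatrix σ i = δ (σ ⟨$⟩ʳ i)

  ∼-permute : (π : Permutation′ m) (ρ : Permutation′ n) (X : Matrix m n) →
              X ∼ λ i j → X (π ⟨$⟩ʳ i) (ρ ⟨$⟩ʳ j)
  ∼-permute π ρ X = record
    { P = permutationMatrix π ; P⁻¹ = permutationMatrix (Perm.flip π)
    ; Q = permutationMatrix ρ ᵀ ; Q⁻¹ = permutationMatrix (Perm.flip ρ) ᵀ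
    ; P-inverse = rows π , rows (Perm.flip π)
    ; Q-inverse = ⊙≈I⇒ᵀ⊙ᵀ≈I (permutationMatrix (Perm.flip ρ)) (permutationMatrix ρ) (rows (Perm.flip ρ))
                , ⊙≈I⇒ᵀ⊙ᵀ≈I (permutationMatrix ρ) (permutationMatrix (Perm.flip ρ)) (rows ρ)
    ; transform = λ i j → begin
        sum (λ l → (Pπ ⊙ X) i l * δ (ρ ⟨$⟩ʳ j) l) ≡⟨ sum-cong-≋ (λ l → cong ((Pπ ⊙ X) i l *_) (δ-sym (ρ ⟨$⟩ʳ j) l)) ⟩
        sum (λ l → (Pπ ⊙ X) i l * δ l (ρ ⟨$⟩ʳ j)) ≡⟨ ∑-δʳ (ρ ⟨$⟩ʳ j) ((Pπ ⊙ X) i) ⟩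
        (Pπ ⊙ X) i (ρ ⟨$⟩ʳ j)                     ≡⟨ ∑-δˡ (π ⟨$⟩ʳ i) (λ l → X l (ρ ⟨$⟩ʳ j)) ⟩
        X (π ⟨$⟩ʳ i) (ρ ⟨$⟩ʳ j)                   ∎ }
    where
      open ≡-Reasoning
      Pπ = permutationMatrix π
      rows : ∀ {k} (σ : Permutation′ k) → permutationMatrix σ ⊙ permutationMatrix (Perm.flip σ) ≈ₘ I
      rows σ i j = trans (∑-δˡ (σ ⟨$⟩ʳ i) (λ l → δ (σ ⟨$⟩ˡ l) j)) (cong (λ k → δ k j) (inverseˡ σ))

  addToRows : (Fin m → Carrier) → Matrix (ℕ.suc m) n → Matrix (ℕ.suc m) n
  addToRows c X zero    j = X zero j
  addToRows c X (suc i) j = c i * X zero j + X (suc i) j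

  rowAdder : (Fin m → Carrier) → Matrix (ℕ.suc m) (ℕ.suc m)
  rowAdder c zero    zero    = 1#
  rowAdder c zero    (suc l) = 0#
  rowAdder c (suc i) zero    = c i
  rowAdder c (suc i) (suc l) = δ i l

  rowAdder-⊙ : (c : Fin m → Carrier) (X : Matrix (ℕ.suc m) n) → rowAdder c ⊙ X ≈ₘ addToRows c X
  rowAdder-⊙ {m} c X zero    j =
    trans (+-cong (*-identityˡ (X zero j)) (∑-zero {m} λ l → zeroˡ (X (suc l) j))) (+-identityʳ (X zero j))
  rowAdder-⊙ c X (suc i) j = +-congˡ (∑-δˡ i (λ l → X (suc l) j))

  rowAdder-⊙-rowAdder : {c c′ : Fin m → Carrier} → (∀ i → c i + c′ i ≡ 0#) → rowAdder c ⊙ rowAdder c′ ≈ₘ I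
  rowAdder-⊙-rowAdder {c = c} {c′} c+c′≡0 i j = trans (rowAdder-⊙ c (rowAdder c′) i j) (entry i j)
    where
      entry : ∀ i j → addToRows c (rowAdder c′) i j ≡ I i j
      entry zero    zero    = refl
      entry zero    (suc j) = refl
      entry (suc i) zero    = trans (+-congʳ (*-identityʳ (c i))) (c+c′≡0 i)
      entry (suc i) (suc j) = trans (+-congʳ (zeroʳ (c i))) (+-identityˡ (δ i j))

  rowAdder-inverse : (c : Fin m → Carrier) → Inverse (rowAdder c) (rowAdder (-_ ∘ c))
  rowAdder-inverse c = rowAdder-⊙-rowAdder (-‿inverseʳ ∘ c) , rowAdder-⊙-rowAdder (-‿inverseˡ ∘ c)

  ∼-addToRows : (c : Fin m → Carrier) (X : Matrix (ℕ.suc m) n) → X ∼ addToRows c X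
  ∼-addToRows c X = record
    { P = rowAdder c ; P⁻¹ = rowAdder (-_ ∘ c) ; Q = I ; Q⁻¹ = I
    ; P-inverse = rowAdder-inverse c
    ; Q-inverse = ⊙-identityˡ I , ⊙-identityˡ I
    ; transform = ≈ₘ-trans (⊙-identityʳ (rowAdder c ⊙ X)) (rowAdder-⊙ c X) }

  addToRows-clears : (X : Matrix (ℕ.suc m) n) (a : Fin m → Carrier) {j : Fin n} →
                     ∀ i → a i * X zero j ≡ X (suc i) j → addToRows (-_ ∘ a) X (suc i) j ≡ 0#
  addToRows-clears X a {j} i aX≡X = begin
    - a i * X zero j + X (suc i) j   ≡⟨ +-congʳ (sym (-‿distribˡ-* (a i) (X zero j))) ⟩
    - (a i * X zero j) + X (suc i) j ≡⟨ +-congˡ (sym aX≡X) ⟩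
    - (a i * X zero j) + a i * X zero j ≡⟨ -‿inverseˡ (a i * X zero j) ⟩
    0#                               ∎
    where open ≡-Reasoning

  ∼-clear : (X : Matrix (ℕ.suc m) (ℕ.suc n)) →
            (∀ i → X zero zero ∣ X (suc i) zero) → (∀ j → X zero zero ∣ X zero (suc j)) →
            Σ (Matrix m n) λ S → X ∼ X zero zero ⊕ S
  ∼-clear X d∣column d∣row =
    (λ i j → Z (suc i) (suc j)) ,
    ∼-trans (∼-addToRows (-_ ∘ a) X) (∼-trans (∼-ᵀ (∼-addToRows (-_ ∘ b) (Y ᵀ))) (∼-reflexive Z≈d⊕S))
    where
      a : Fin _ → Carrier
      a i = _∣ʳ_.quotient (d∣column i)
      b : Fin _ → Carrier
      b j = _∣ʳ_.quotient (d∣row j)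
      Y = addToRows (-_ ∘ a) X
      Z = addToRows (-_ ∘ b) (Y ᵀ) ᵀ
      Z≈d⊕S : Z ≈ₘ X zero zero ⊕ λ i j → Z (suc i) (suc j)
      Z≈d⊕S zero    zero    = refl
      Z≈d⊕S zero    (suc j) = addToRows-clears (Y ᵀ) b {zero} j (_∣ʳ_.equality (d∣row j))
      Z≈d⊕S (suc i) zero    = addToRows-clears X a {zero} i (_∣ʳ_.equality (d∣column i))
      Z≈d⊕S (suc i) (suc j) = refl

  minimal-entry : ∀ {k} (f : Fin (ℕ.suc k) → Carrier) → Σ (Fin (ℕ.suc k)) λ j → ∀ j′ → f j ∣ f j′
  minimal-entry {ℕ.zero} f = zero , λ { zero → ∣ʳ-refl }
  minimal-entry {ℕ.suc k} f with minimal-entry (f ∘ suc)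
  ... | j , fj∣ with ∣-total (f zero) (f (suc j))
  ...   | inj₁ f0∣fj = zero , λ { zero → ∣ʳ-refl ; (suc j′) → ∣ʳ-trans f0∣fj (fj∣ j′) }
  ...   | inj₂ fj∣f0 = suc j , λ { zero → fj∣f0 ; (suc j′) → fj∣ j′ }

  pivot : (X : Matrix (ℕ.suc m) (ℕ.suc n)) → ∃₂ λ i j → ∀ i′ j′ → X i j ∣ X i′ j′
  pivot X = i , column i , λ i′ j′ → ∣ʳ-trans (X[i]∣ i′) (proj₂ (minimal-entry (X i′)) j′)
    where
      column : Fin _ → Fin _
      column i = proj₁ (minimal-entry (X i))
      i = proj₁ (minimal-entry λ i → X i (column i))
      X[i]∣ = proj₂ (minimal-entry λ i → X i (column i))

  record IsDiagonal (r : ℕ) (D : Matrix m n) : Set where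
    field
      r≤m : r ≤ m
      r≤n : r ≤ n
      off-diagonal : ∀ {i j} → toℕ i ≢ toℕ j → D i j ≡ 0#
      beyond-rank : ∀ {i j} → r ≤ toℕ i → D i j ≡ 0#
      diagonal≢0 : ∀ k → D (Fin.inject≤ k r≤m) (Fin.inject≤ k r≤n) ≢ 0#

  zero-isDiagonal : {D : Matrix m n} → D ≈ₘ O → IsDiagonal 0 D
  zero-isDiagonal D≈O = record
    { r≤m = z≤n ; r≤n = z≤n
    ; off-diagonal = λ {i} {j} _ → D≈O i j
    ; beyond-rank = λ {i} {j} _ → D≈O i j
    ; diagonal≢0 = λ () }

  ⊕-isDiagonal : ∀ {r d} {D : Matrix m n} → d ≢ 0# → IsDiagonal r D → IsDiagonal (ℕ.suc r) (d ⊕ D)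
  ⊕-isDiagonal {r = r} {d} {D} d≢0 D-diagonal = record
    { r≤m = s≤s r≤m ; r≤n = s≤s r≤n
    ; off-diagonal = off-diagonal′
    ; beyond-rank = beyond-rank′
    ; diagonal≢0 = λ { zero → d≢0 ; (suc k) → diagonal≢0 k } }
    where
      open IsDiagonal D-diagonal
      off-diagonal′ : ∀ {i j} → toℕ i ≢ toℕ j → (d ⊕ D) i j ≡ 0#
      off-diagonal′ {zero}  {zero}  0≢0 = ⊥-elim (0≢0 ≡.refl)
      off-diagonal′ {zero}  {suc j} _   = refl
      off-diagonal′ {suc i} {zero}  _   = refl
      off-diagonal′ {suc i} {suc j} i≢j = off-diagonal (i≢j ∘ cong ℕ.suc)
      beyond-rank′ : ∀ {i j} → ℕ.suc r ≤ toℕ i → (d ⊕ D) i j ≡ 0#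
      beyond-rank′ {suc i} {zero}  _         = refl
      beyond-rank′ {suc i} {suc j} (s≤s r≤i) = beyond-rank r≤i

  record SmithForm (X : Matrix m n) : Set where
    field
      rank : ℕ
      D : Matrix m n
      X∼D : X ∼ D
      diagonal : IsDiagonal rank D

  zero-smithForm : {X : Matrix m n} → X ≈ₘ O → SmithForm X
  zero-smithForm {X = X} X≈O = record
    { rank = 0 ; D = X ; X∼D = ∼-reflexive ≈ₘ-refl ; diagonal = zero-isDiagonal X≈O }

  -- Opaque: unfolding this recursion on symbolic entries makes typechecking of its users explode.
  opaque
    smithForm : (X : Matrix m n) → SmithForm X
    smithForm {ℕ.zero} X = zero-smithForm λ ()
    smithForm {ℕ.suc m} {ℕ.zero} X = zero-smithForm λ i ()
    smithForm {ℕ.suc m} {ℕ.suc n} X with pivot X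
    ... | i₀ , j₀ , pivot∣ with X i₀ j₀ ≟ 0#
    ...   | yes pivot≡0 = zero-smithForm λ i j → let open _∣ʳ_ (pivot∣ i j) in
      trans (sym equality) (trans (cong (quotient *_) pivot≡0) (zeroʳ quotient))
    ...   | no pivot≢0 = record
      { rank = ℕ.suc S.rank
      ; D = X i₀ j₀ ⊕ S.D
      ; X∼D = ∼-trans X∼X′ (∼-trans X′∼d⊕S (∼-⊕ (X i₀ j₀) S.X∼D))
      ; diagonal = ⊕-isDiagonal pivot≢0 S.diagonal }
      where
        X′ : Matrix (ℕ.suc m) (ℕ.suc n)
        X′ i j = X (Perm.transpose zero i₀ ⟨$⟩ʳ i) (Perm.transpose zero j₀ ⟨$⟩ʳ j)
        X∼X′ : X ∼ X′
        X∼X′ = ∼-permute (Perm.transpose zero i₀) (Perm.transpose zero j₀) X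
        cleared : Σ (Matrix m n) λ S → X′ ∼ X i₀ j₀ ⊕ S
        cleared = ∼-clear X′ (λ i → pivot∣ _ _) (λ j → pivot∣ _ _)
        X′∼d⊕S : X′ ∼ X i₀ j₀ ⊕ proj₁ cleared
        X′∼d⊕S = proj₂ cleared
        module S = SmithForm (smithForm (proj₁ cleared))

module MatrixRank (R : ChainRing) where
  open import Data.Fin as Fin using (Fin; zero; toℕ; inject≤)
  import Data.Fin.Properties as Fin
  open import Data.Nat as ℕ using (ℕ; _≤_; _<_; _∸_)
  import Data.Nat.Properties as ℕ
  open import Data.Product using (Σ; _×_; _,_; proj₁; proj₂)
  import Relation.Nullary
  open import Relation.Nullary using (yes; no; contradiction)
  import Relation.Binary.PropositionalEquality as ≡
  open import Relation.Binary.PropositionalEquality using (_≡_; _≢_; cong; subst; module ≡-Reasoning)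

  open ChainRing R hiding (zero)
  open Matrices commutativeRing
  open SmithNormalForm R

  private variable k m n : ℕ

  1≢0 : 1# ≢ 0#
  1≢0 1≡0 = socle≢0 (begin
    socle      ≡⟨ *-identityʳ socle ⟨
    socle * 1# ≡⟨ cong (socle *_) 1≡0 ⟩
    socle * 0# ≡⟨ zeroʳ socle ⟩
    0#         ∎)
    where open ≡-Reasoning

  ∼-P⊙ : {X D : Matrix m n} (X∼D : X ∼ D) → _∼_.P X∼D ⊙ X ≈ₘ D ⊙ _∼_.Q⁻¹ X∼D
  ∼-P⊙ {X = X} {D} X∼D = begin
    P ⊙ X               ≈⟨ ⊙-identityʳ (P ⊙ X) ⟨
    P ⊙ X ⊙ I           ≈⟨ ⊙-congˡ (P ⊙ X) (proj₁ Q-inverse) ⟨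
    P ⊙ X ⊙ (Q ⊙ Q⁻¹)   ≈⟨ ⊙-assoc (P ⊙ X) Q Q⁻¹ ⟨
    P ⊙ X ⊙ Q ⊙ Q⁻¹     ≈⟨ ⊙-congʳ Q⁻¹ transform ⟩
    D ⊙ Q⁻¹             ∎
    where
      open _∼_ X∼D
      open ≈ₘ-Reasoning

  scalar-factorisation-≤ : ∀ {s} → s ≢ 0# → (X : Matrix k m) (Y : Matrix m k) → X ⊙ Y ≈ₘ s ⋆ I → k ≤ m
  scalar-factorisation-≤ {k} {m} {s} s≢0 X Y XY≈sI = ℕ.≤-trans k≤rank r≤n
    where
      open SmithForm (smithForm X)
      open IsDiagonal diagonal
      open _∼_ X∼D
      sI≈DW : s ⋆ I ≈ₘ D ⊙ (Q⁻¹ ⊙ Y ⊙ P⁻¹)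
      sI≈DW = begin
        s ⋆ I                   ≈⟨ ⋆-cong s (proj₁ P-inverse) ⟨
        s ⋆ (P ⊙ P⁻¹)           ≈⟨ ⋆-⊙ s P P⁻¹ ⟨
        s ⋆ P ⊙ P⁻¹             ≈⟨ ⊙-congʳ P⁻¹ (≈ₘ-trans (⊙-⋆ s P I) (⋆-cong s (⊙-identityʳ P))) ⟨
        P ⊙ (s ⋆ I) ⊙ P⁻¹       ≈⟨ ⊙-congʳ P⁻¹ (⊙-congˡ P XY≈sI) ⟨
        P ⊙ (X ⊙ Y) ⊙ P⁻¹       ≈⟨ ⊙-congʳ P⁻¹ (⊙-assoc P X Y) ⟨
        P ⊙ X ⊙ Y ⊙ P⁻¹         ≈⟨ ⊙-congʳ P⁻¹ (⊙-congʳ Y (∼-P⊙ X∼D)) ⟩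
        D ⊙ Q⁻¹ ⊙ Y ⊙ P⁻¹       ≈⟨ ⊙-congʳ P⁻¹ (⊙-assoc D Q⁻¹ Y) ⟩
        D ⊙ (Q⁻¹ ⊙ Y) ⊙ P⁻¹     ≈⟨ ⊙-assoc D (Q⁻¹ ⊙ Y) P⁻¹ ⟩
        D ⊙ (Q⁻¹ ⊙ Y ⊙ P⁻¹)     ∎
        where open ≈ₘ-Reasoning
      k≤rank : k ≤ rank
      k≤rank with k ℕ.≤? rank
      ... | yes k≤r = k≤r
      ... | no k≰r = contradiction s≡0 s≢0
        where
          i = Fin.fromℕ< (ℕ.≰⇒> k≰r)
          s≡0 : s ≡ 0#
          s≡0 = trans (sym (⋆-I s i)) (trans (sI≈DW i i)
                  (⊙-zero-row D (Q⁻¹ ⊙ Y ⊙ P⁻¹) (λ l → beyond-rank (ℕ.≤-reflexive (≡.sym (Fin.toℕ-fromℕ< _)))) i))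

  right-invertible-factor-≤ : ∀ {a} (K : Matrix k n) (C : Matrix k a) (A : Matrix a n) →
                              HasRightInverse K → K ≈ₘ C ⊙ A → k ≤ a
  right-invertible-factor-≤ K C A (N , KN≈I) K≈CA = scalar-factorisation-≤ 1≢0 C (A ⊙ N) (begin
    C ⊙ (A ⊙ N)   ≈⟨ ⊙-assoc C A N ⟨
    C ⊙ A ⊙ N     ≈⟨ ⊙-congʳ N K≈CA ⟨
    K ⊙ N         ≈⟨ KN≈I ⟩
    I             ≈⟨ (λ i j → *-identityˡ (δ i j)) ⟨
    1# ⋆ I        ∎)
    where open ≈ₘ-Reasoning

  module SmithConsequences (X : Matrix m n) where

    open SmithForm (smithForm X) public using (rank)
    open SmithForm (smithForm X) using (D; X∼D; diagonal)
    open IsDiagonal diagonal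
    open _∼_ X∼D

    rank≤rows : rank ≤ m
    rank≤rows = r≤m

    κ : Fin rank → Fin m
    κ a = inject≤ a r≤m

    ι : Fin rank → Fin n
    ι a = inject≤ a r≤n

    toℕ-κ≡toℕ-ι : ∀ a → toℕ (κ a) ≡ toℕ (ι a)
    toℕ-κ≡toℕ-ι a = ≡.trans (Fin.toℕ-inject≤ a r≤m) (≡.sym (Fin.toℕ-inject≤ a r≤n))

    D-beyond-column : ∀ i {j} → rank ≤ toℕ j → D i j ≡ 0#
    D-beyond-column i {j} r≤j with toℕ i ℕ.≟ toℕ j
    ... | yes i≡j = beyond-rank (subst (rank ≤_) (≡.sym i≡j) r≤j)
    ... | no i≢j = off-diagonal i≢j

    D-diagonal-block : ∀ a b → a ≢ b → D (κ a) (ι b) ≡ 0#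
    D-diagonal-block a b a≢b = off-diagonal λ κa≡ιb →
      a≢b (Fin.toℕ-injective (≡.trans (≡.sym (Fin.toℕ-inject≤ a r≤m)) (≡.trans κa≡ιb (Fin.toℕ-inject≤ b r≤n))))

    socle-multiplier : ∀ a → Σ Carrier λ λₐ → λₐ * D (κ a) (ι a) ≡ socle
    socle-multiplier a = let open _∣ʳ_ (∣socle (diagonal≢0 a)) in quotient , equality

    -- Each nonzero diagonal entry of D divides the socle, so rescaling the rows that meet them
    -- turns the leading block of any factorisation of D into socle · I.
    socle-block : ∀ {k} (U : Matrix m k) (V : Matrix k n) → U ⊙ V ≈ₘ D →
                  (λ a l → proj₁ (socle-multiplier a) * U (κ a) l) ⊙ (λ l b → V l (ι b)) ≈ₘ socle ⋆ I
    socle-block U V UV≈D a b = begin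
      sum (λ l → λₐ * U (κ a) l * V l (ι b))   ≡⟨ sum-cong-≋ (λ l → *-assoc λₐ (U (κ a) l) (V l (ι b))) ⟩
      sum (λ l → λₐ * (U (κ a) l * V l (ι b))) ≡⟨ *-distribˡ-sum λₐ (λ l → U (κ a) l * V l (ι b)) ⟨
      λₐ * (U ⊙ V) (κ a) (ι b)                 ≡⟨ cong (λₐ *_) (UV≈D (κ a) (ι b)) ⟩
      λₐ * D (κ a) (ι b)                        ≡⟨ entry (a Fin.≟ b) ⟩
      socle * δ a b                             ∎
      where
        open ≡-Reasoning
        λₐ = proj₁ (socle-multiplier a)
        entry : Relation.Nullary.Dec (a ≡ b) → λₐ * D (κ a) (ι b) ≡ socle * δ a b
        entry (yes ≡.refl) = trans (proj₂ (socle-multiplier a)) (sym (⋆-I socle a))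
        entry (no a≢b) = begin
          λₐ * D (κ a) (ι b) ≡⟨ cong (λₐ *_) (D-diagonal-block a b a≢b) ⟩
          λₐ * 0#            ≡⟨ zeroʳ λₐ ⟩
          0#                 ≡⟨ zeroʳ socle ⟨
          socle * 0#         ≡⟨ cong (socle *_) (δ-≢ a≢b) ⟨
          socle * δ a b      ∎

    rank-≤-factorisation : ∀ {k} (C : Matrix m k) (E : Matrix k n) → X ≈ₘ C ⊙ E → rank ≤ k
    rank-≤-factorisation C E X≈CE = scalar-factorisation-≤ socle≢0 _ _ (socle-block (P ⊙ C) (E ⊙ Q) PC⊙EQ≈D)
      where
        PC⊙EQ≈D : P ⊙ C ⊙ (E ⊙ Q) ≈ₘ D
        PC⊙EQ≈D = begin
          P ⊙ C ⊙ (E ⊙ Q)   ≈⟨ ⊙-assoc (P ⊙ C) E Q ⟨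
          P ⊙ C ⊙ E ⊙ Q     ≈⟨ ⊙-congʳ Q (⊙-assoc P C E) ⟩
          P ⊙ (C ⊙ E) ⊙ Q   ≈⟨ ⊙-congʳ Q (⊙-congˡ P X≈CE) ⟨
          P ⊙ X ⊙ Q         ≈⟨ transform ⟩
          D                 ∎
          where open ≈ₘ-Reasoning

    X≈P⁻¹DQ⁻¹ : X ≈ₘ P⁻¹ ⊙ (D ⊙ Q⁻¹)
    X≈P⁻¹DQ⁻¹ = begin
      X                 ≈⟨ ⊙-identityˡ X ⟨
      I ⊙ X             ≈⟨ ⊙-congʳ X (proj₂ P-inverse) ⟨
      P⁻¹ ⊙ P ⊙ X       ≈⟨ ⊙-assoc P⁻¹ P X ⟩
      P⁻¹ ⊙ (P ⊙ X)     ≈⟨ ⊙-congˡ P⁻¹ (∼-P⊙ X∼D) ⟩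
      P⁻¹ ⊙ (D ⊙ Q⁻¹)   ∎
      where open ≈ₘ-Reasoning

    rank-factorisation : Σ (Matrix m rank) λ G → Σ (Matrix rank n) λ K → X ≈ₘ G ⊙ K × HasRightInverse K
    rank-factorisation = P⁻¹ ⊙ E , F ⊙ Q⁻¹ , X≈GK , Q ⊙ F ᵀ , KN≈I
      where
        F : Matrix rank n
        F a = δ (ι a)
        E : Matrix m rank
        E i a = D i (ι a)
        EF≈D : E ⊙ F ≈ₘ D
        EF≈D i j = begin
          (E ⊙ F) i j                                ≡⟨ +-identityʳ _ ⟨
          (E ⊙ F) i j + 0#
            ≡⟨ +-congˡ (∑-zero {n ∸ rank} λ h → trans (*-congʳ (D-beyond-column i (r≤raise {h}))) (zeroˡ _)) ⟨
          (E ⊙ F) i j + sum (λ h → D i (raise≤ r≤n h) * δ (raise≤ r≤n h) j)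
            ≡⟨ ∑-inject≤-raise≤ r≤n (λ l → D i l * δ l j) ⟨
          (D ⊙ I) i j                                ≡⟨ ⊙-identityʳ D i j ⟩
          D i j                                      ∎
          where
            open ≡-Reasoning
            r≤raise : ∀ {h} → rank ≤ toℕ (raise≤ r≤n h)
            r≤raise {h} = ℕ.≤-trans (ℕ.m≤m+n rank (toℕ h)) (ℕ.≤-reflexive (≡.sym (toℕ-raise≤ r≤n h)))
        X≈GK : X ≈ₘ P⁻¹ ⊙ E ⊙ (F ⊙ Q⁻¹)
        X≈GK = begin
          X                     ≈⟨ X≈P⁻¹DQ⁻¹ ⟩
          P⁻¹ ⊙ (D ⊙ Q⁻¹)       ≈⟨ ⊙-congˡ P⁻¹ (⊙-congʳ Q⁻¹ EF≈D) ⟨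
          P⁻¹ ⊙ (E ⊙ F ⊙ Q⁻¹)   ≈⟨ ⊙-congˡ P⁻¹ (⊙-assoc E F Q⁻¹) ⟩
          P⁻¹ ⊙ (E ⊙ (F ⊙ Q⁻¹)) ≈⟨ ⊙-assoc P⁻¹ E (F ⊙ Q⁻¹) ⟨
          P⁻¹ ⊙ E ⊙ (F ⊙ Q⁻¹)   ∎
          where open ≈ₘ-Reasoning
        KN≈I : F ⊙ Q⁻¹ ⊙ (Q ⊙ F ᵀ) ≈ₘ I
        KN≈I = ≈ₘ-trans (⊙-cancel {P = Q⁻¹} {Q} F (F ᵀ) (proj₂ Q-inverse)) λ a b →
          trans (∑-δˡ (ι a) (δ (ι b)))
                (≡.trans (δ-injective {f = ι} (Fin.inject≤-injective r≤n r≤n _ _) b a) (δ-sym b a))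

    raised : Fin (m ∸ rank) → Fin m
    raised = raise≤ r≤m

    rank≤raised : ∀ h → rank ≤ toℕ (raised h)
    rank≤raised h = ℕ.≤-trans (ℕ.m≤m+n rank (toℕ h)) (ℕ.≤-reflexive (≡.sym (toℕ-raise≤ r≤m h)))

    left-kernel : Σ (Matrix (m ∸ rank) m) λ L → L ⊙ X ≈ₘ O × HasRightInverse L
    left-kernel = L , LX≈O , Z , LZ≈I
      where
        L : Matrix (m ∸ rank) m
        L h = P (raised h)
        Z : Matrix m (m ∸ rank)
        Z l h = P⁻¹ l (raised h)
        LX≈O : L ⊙ X ≈ₘ O
        LX≈O h j = trans (∼-P⊙ X∼D (raised h) j) (⊙-zero-row D Q⁻¹ (λ l → beyond-rank (rank≤raised h)) j)
        LZ≈I : L ⊙ Z ≈ₘ I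
        LZ≈I h h′ = trans (proj₁ P-inverse (raised h) (raised h′)) (reflexive (δ-injective (raise≤-injective r≤m) h h′))

    left-annihilator-≤ : ∀ {k} (Y : Matrix k m) (T : Matrix m k) → Y ⊙ X ≈ₘ O → Y ⊙ T ≈ₘ I → k ≤ m ∸ rank
    left-annihilator-≤ {k} Y T YX≈O YT≈I =
      scalar-factorisation-≤ socle≢0 (λ i h → socle * Y′ i (raised h)) (λ h j → (P ⊙ T) (raised h) j) socle⋆I≈
      where
        Y′ = Y ⊙ P⁻¹
        Y′D≈O : Y′ ⊙ D ≈ₘ O
        Y′D≈O = begin
          Y ⊙ P⁻¹ ⊙ D               ≈⟨ ⊙-congˡ (Y ⊙ P⁻¹) transform ⟨
          Y ⊙ P⁻¹ ⊙ (P ⊙ X ⊙ Q)     ≈⟨ ⊙-congˡ (Y ⊙ P⁻¹) (⊙-assoc P X Q) ⟩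
          Y ⊙ P⁻¹ ⊙ (P ⊙ (X ⊙ Q))   ≈⟨ ⊙-cancel {P = P⁻¹} {P} Y (X ⊙ Q) (proj₂ P-inverse) ⟩
          Y ⊙ (X ⊙ Q)               ≈⟨ ⊙-assoc Y X Q ⟨
          Y ⊙ X ⊙ Q                 ≈⟨ ⊙-congʳ Q YX≈O ⟩
          O ⊙ Q                     ≈⟨ ⊙-zeroˡ Q ⟩
          O                         ∎
          where open ≈ₘ-Reasoning
        socle-kills : ∀ i a → socle * Y′ i (κ a) ≡ 0#
        socle-kills i a = begin
          socle * y                 ≡⟨ cong (_* y) (proj₂ (socle-multiplier a)) ⟨
          λₐ * d * y                ≡⟨ *-assoc λₐ d y ⟩
          λₐ * (d * y)              ≡⟨ cong (λₐ *_) (*-comm d y) ⟩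
          λₐ * (y * d)              ≡⟨ cong (λₐ *_) y*d≡0 ⟩
          λₐ * 0#                   ≡⟨ zeroʳ λₐ ⟩
          0#                        ∎
          where
            open ≡-Reasoning
            λₐ = proj₁ (socle-multiplier a)
            d = D (κ a) (ι a)
            y = Y′ i (κ a)
            y*d≡0 : y * d ≡ 0#
            y*d≡0 = trans (sym (∑-single (κ a) (λ l → Y′ i l * D l (ι a)) λ l l≢κa →
                      trans (cong (Y′ i l *_) (off-diagonal λ eq → l≢κa (Fin.toℕ-injective (≡.trans eq (≡.sym (toℕ-κ≡toℕ-ι a))))))
                            (zeroʳ (Y′ i l))))
                          (Y′D≈O i (ι a))
        socle⋆I≈ : (λ i h → socle * Y′ i (raised h)) ⊙ (λ h j → (P ⊙ T) (raised h) j) ≈ₘ socle ⋆ I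
        socle⋆I≈ i j = sym (begin
          socle * I i j                                      ≡⟨ cong (socle *_) (YT≈I i j) ⟨
          socle * (Y ⊙ T) i j                                ≡⟨ cong (socle *_) (⊙-cancel {P = P⁻¹} {P} Y T (proj₂ P-inverse) i j) ⟨
          socle * (Y′ ⊙ (P ⊙ T)) i j                         ≡⟨ *-distribˡ-sum socle (λ l → Y′ i l * (P ⊙ T) l j) ⟩
          sum (λ l → socle * (Y′ i l * (P ⊙ T) l j))         ≡⟨ sum-cong-≋ (λ l → *-assoc socle (Y′ i l) ((P ⊙ T) l j)) ⟨
          sum (λ l → socle * Y′ i l * (P ⊙ T) l j)           ≡⟨ ∑-inject≤-raise≤ r≤m (λ l → socle * Y′ i l * (P ⊙ T) l j) ⟩
          sum (λ a → socle * Y′ i (κ a) * (P ⊙ T) (κ a) j) + S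
            ≡⟨ +-congʳ (∑-zero λ a → trans (cong (_* (P ⊙ T) (κ a) j) (socle-kills i a)) (zeroˡ _)) ⟩
          0# + S                                             ≡⟨ +-identityˡ S ⟩
          S                                                  ∎)
          where
            open ≡-Reasoning
            S = sum λ h → socle * Y′ i (raised h) * (P ⊙ T) (raised h) j

module JoinAndMeet (R : ChainRing) {a b n : ℕ}
                   (A : Matrices.Matrix (ChainRing.commutativeRing R) a n)
                   (B : Matrices.Matrix (ChainRing.commutativeRing R) b n) where
  open import Data.Fin as Fin using (_↑ˡ_; _↑ʳ_)
  open import Data.Nat as ℕ using (ℕ; _≤_; _∸_)
  open import Data.Product using (_,_; proj₁; proj₂)
  open import Data.Vec.Functional using (_++_)
  import Data.Vec.Functional.Properties as Vector
  open import Relation.Binary.PropositionalEquality using (_≡_; cong; cong₂; module ≡-Reasoning)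

  open ChainRing R hiding (zero)
  open Matrices commutativeRing
  open MatrixRank R
  open import Algebra.Properties.Group +-group using (inverseˡ-unique)

  open SmithConsequences (A ++ B) public using (rank; rank≤rows; rank-factorisation; rank-≤-factorisation)
  open SmithConsequences (A ++ B) using (left-kernel; left-annihilator-≤)

  A++B-top : ∀ i j → (A ++ B) (i ↑ˡ b) j ≡ A i j
  A++B-top i j = cong (λ row → row j) (Vector.lookup-++ˡ A B i)

  A++B-bottom : ∀ i j → (A ++ B) (a ↑ʳ i) j ≡ B i j
  A++B-bottom i j = cong (λ row → row j) (Vector.lookup-++ʳ A B i)

  record JoinBasis : Set where
    field
      K : Matrix rank n
      K-invertible : HasRightInverse K
      Gᴬ : Matrix a rank
      A≈GᴬK : A ≈ₘ Gᴬ ⊙ K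
      Gᴮ : Matrix b rank
      B≈GᴮK : B ≈ₘ Gᴮ ⊙ K

  join-basis : JoinBasis
  join-basis = record
    { K = K
    ; K-invertible = K-invertible
    ; Gᴬ = λ i → G (i ↑ˡ b)
    ; A≈GᴬK = λ i j → trans (sym (A++B-top i j)) (A++B≈GK (i ↑ˡ b) j)
    ; Gᴮ = λ i → G (a ↑ʳ i)
    ; B≈GᴮK = λ i j → trans (sym (A++B-bottom i j)) (A++B≈GK (a ↑ʳ i) j) }
    where
      G = proj₁ rank-factorisation
      K = proj₁ (proj₂ rank-factorisation)
      A++B≈GK = proj₁ (proj₂ (proj₂ rank-factorisation))
      K-invertible = proj₂ (proj₂ (proj₂ rank-factorisation))

  meet-bound : ∀ {k} (K : Matrix k n) (C : Matrix k a) (E : Matrix k b) →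
               HasRightInverse K → K ≈ₘ C ⊙ A → K ≈ₘ E ⊙ B → k ≤ a ℕ.+ b ∸ rank
  meet-bound K C E (N , KN≈I) K≈CA K≈EB = left-annihilator-≤ Y T Y⊙A++B≈O Y⊙T≈I
    where
      Y : Matrix _ (a ℕ.+ b)
      Y i = C i ++ (⊟ E) i
      T : Matrix (a ℕ.+ b) _
      T = (A ⊙ N) ++ O
      Y⊙A++B≈O : Y ⊙ (A ++ B) ≈ₘ O
      Y⊙A++B≈O i j = begin
        (Y ⊙ (A ++ B)) i j            ≡⟨ ++-⊙-++ C (⊟ E) A B i j ⟩
        (C ⊙ A) i j + (⊟ E ⊙ B) i j   ≡⟨ cong₂ _+_ (K≈CA i j) (⊟-distribˡ-⊙ E B i j) ⟨
        K i j + - (E ⊙ B) i j         ≡⟨ cong (λ x → K i j + - x) (K≈EB i j) ⟨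
        K i j + - K i j               ≡⟨ -‿inverseʳ (K i j) ⟩
        0#                            ∎
        where open ≡-Reasoning
      Y⊙T≈I : Y ⊙ T ≈ₘ I
      Y⊙T≈I i j = begin
        (Y ⊙ T) i j                        ≡⟨ ++-⊙-++ C (⊟ E) (A ⊙ N) O i j ⟩
        (C ⊙ (A ⊙ N)) i j + (⊟ E ⊙ O) i j  ≡⟨ cong₂ _+_ (⊙-assoc C A N i j) (sym (⊙-zeroʳ (⊟ E) i j)) ⟨
        (C ⊙ A ⊙ N) i j + 0#               ≡⟨ +-identityʳ _ ⟩
        (C ⊙ A ⊙ N) i j                    ≡⟨ ⊙-congʳ N K≈CA i j ⟨
        (K ⊙ N) i j                        ≡⟨ KN≈I i j ⟩
        I i j                              ∎
        where open ≡-Reasoning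

  record MeetBasis : Set where
    field
      K : Matrix (a ℕ.+ b ∸ rank) n
      K-invertible : HasRightInverse K
      Cᴬ : Matrix (a ℕ.+ b ∸ rank) a
      K≈CᴬA : K ≈ₘ Cᴬ ⊙ A
      Cᴮ : Matrix (a ℕ.+ b ∸ rank) b
      K≈CᴮB : K ≈ₘ Cᴮ ⊙ B

  meet-basis : HasRightInverse A → HasRightInverse B → MeetBasis
  meet-basis (NA , ANA≈I) (NB , BNB≈I) = record
    { K = U ⊙ A
    ; K-invertible = NA ⊙ Zˡ ⊞ ⊟ (NB ⊙ Zʳ) , UA⊙N≈I
    ; Cᴬ = U
    ; K≈CᴬA = ≈ₘ-refl
    ; Cᴮ = ⊟ W
    ; K≈CᴮB = UA≈-W⊙B }
    where
      L = proj₁ left-kernel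
      LA++B≈O = proj₁ (proj₂ left-kernel)
      Z = proj₁ (proj₂ (proj₂ left-kernel))
      LZ≈I = proj₂ (proj₂ (proj₂ left-kernel))
      U = λ h x → L h (x ↑ˡ b)
      W = λ h x → L h (a ↑ʳ x)
      Zˡ = λ x → Z (x ↑ˡ b)
      Zʳ = λ x → Z (a ↑ʳ x)
      UA+WB≈O : ∀ h j → (U ⊙ A) h j + (W ⊙ B) h j ≡ 0#
      UA+WB≈O h j = begin
        (U ⊙ A) h j + (W ⊙ B) h j
          ≡⟨ cong₂ _+_ (⊙-congˡ U A++B-top h j) (⊙-congˡ W A++B-bottom h j) ⟨
        (U ⊙ (λ x → (A ++ B) (x ↑ˡ b))) h j + (W ⊙ (λ x → (A ++ B) (a ↑ʳ x))) h j
          ≡⟨ ⊙-split {a = a} {b} L (A ++ B) h j ⟨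
        (L ⊙ (A ++ B)) h j
          ≡⟨ LA++B≈O h j ⟩
        0#
          ∎
        where open ≡-Reasoning
      UA≈-W⊙B : U ⊙ A ≈ₘ ⊟ W ⊙ B
      UA≈-W⊙B h j = trans (inverseˡ-unique _ _ (UA+WB≈O h j)) (⊟-distribˡ-⊙ W B h j)
      UZˡ+WZʳ≈I : U ⊙ Zˡ ⊞ W ⊙ Zʳ ≈ₘ I
      UZˡ+WZʳ≈I = ≈ₘ-trans (≈ₘ-sym (⊙-split {a = a} {b} L Z)) LZ≈I
      UA⊙N≈I : U ⊙ A ⊙ (NA ⊙ Zˡ ⊞ ⊟ (NB ⊙ Zʳ)) ≈ₘ I
      UA⊙N≈I = begin
        U ⊙ A ⊙ (NA ⊙ Zˡ ⊞ ⊟ (NB ⊙ Zʳ))                ≈⟨ ⊙-distribˡ-⊞ (U ⊙ A) (NA ⊙ Zˡ) (⊟ (NB ⊙ Zʳ)) ⟩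
        U ⊙ A ⊙ (NA ⊙ Zˡ) ⊞ U ⊙ A ⊙ ⊟ (NB ⊙ Zʳ)        ≈⟨ ⊞-cong (⊙-cancel {P = A} {NA} U Zˡ ANA≈I) B-part ⟩
        U ⊙ Zˡ ⊞ W ⊙ Zʳ                                ≈⟨ UZˡ+WZʳ≈I ⟩
        I                                              ∎
        where
          open ≈ₘ-Reasoning
          B-part : U ⊙ A ⊙ ⊟ (NB ⊙ Zʳ) ≈ₘ W ⊙ Zʳ
          B-part = begin
            U ⊙ A ⊙ ⊟ (NB ⊙ Zʳ)       ≈⟨ ⊟-distribʳ-⊙ (U ⊙ A) (NB ⊙ Zʳ) ⟨
            ⊟ (U ⊙ A ⊙ (NB ⊙ Zʳ))     ≈⟨ ⊟-cong (⊙-congʳ (NB ⊙ Zʳ) UA≈-W⊙B) ⟩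
            ⊟ (⊟ W ⊙ B ⊙ (NB ⊙ Zʳ))   ≈⟨ ⊟-cong (⊙-cancel {P = B} {NB} (⊟ W) Zʳ BNB≈I) ⟩
            ⊟ (⊟ W ⊙ Zʳ)              ≈⟨ ⊟-cong (⊟-distribˡ-⊙ W Zʳ) ⟨
            ⊟ ⊟ (W ⊙ Zʳ)              ≈⟨ ⊟-involutive (W ⊙ Zʳ) ⟩
            W ⊙ Zʳ                    ∎

module IntegersModulo (q : ℕ) .{{_ : NonZero q}} where
  open import Defs
  open import Algebra.Structures using (IsCommutativeRing)
  open import Algebra.Consequences.Propositional using (comm∧idˡ⇒id; comm∧invˡ⇒inv; comm∧distrʳ⇒distrˡ)
  open import Data.Nat as ℕ using (ℕ; _+_; _*_; _∸_; _%_; _<_; NonZero)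
  import Data.Nat.Properties as ℕ
  open import Data.Nat.DivMod
  open import Data.Fin using (Fin; toℕ)
  open import Data.Fin.Properties using (toℕ-injective; toℕ-fromℕ<; toℕ≤n)
  open import Data.Product using (_,_)
  open import Level using (0ℓ)
  open import Relation.Binary.PropositionalEquality hiding ([_])

  [_] : ℕ → R q
  [ m ] = m mod q

  toℕ-[] : ∀ m → toℕ [ m ] ≡ m % q
  toℕ-[] m = toℕ-fromℕ< _

  []-cong-% : ∀ {m n} → m % q ≡ n % q → [ m ] ≡ [ n ]
  []-cong-% {m} {n} eq = toℕ-injective (trans (toℕ-[] m) (trans eq (sym (toℕ-[] n))))

  [toℕ] : ∀ x → [ toℕ x ] ≡ x
  [toℕ] x = toℕ-injective (trans (toℕ-[] (toℕ x)) (m<n⇒m%n≡m (Data.Fin.Properties.toℕ<n x)))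

  []-injective : ∀ {m n} → m < q → n < q → [ m ] ≡ [ n ] → m ≡ n
  []-injective {m} {n} m<q n<q eq = begin
    m          ≡⟨ m<n⇒m%n≡m m<q ⟨
    m % q      ≡⟨ toℕ-[] m ⟨
    toℕ [ m ]  ≡⟨ cong toℕ eq ⟩
    toℕ [ n ]  ≡⟨ toℕ-[] n ⟩
    n % q      ≡⟨ m<n⇒m%n≡m n<q ⟩
    n          ∎
    where open ≡-Reasoning

  []-+ : ∀ m n → [ m ] +ᵣ [ n ] ≡ [ m + n ]
  []-+ m n = []-cong-% (trans (cong₂ (λ a b → (a + b) % q) (toℕ-[] m) (toℕ-[] n)) (sym (%-distribˡ-+ m n q)))

  []-* : ∀ m n → [ m ] *ᵣ [ n ] ≡ [ m * n ]
  []-* m n = []-cong-% (trans (cong₂ (λ a b → (a * b) % q) (toℕ-[] m) (toℕ-[] n)) (sym (%-distribˡ-* m n q)))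

  [q]≡0 : [ q ] ≡ 0ᵣ
  [q]≡0 = []-cong-% (trans (n%n≡0 q) (sym (m<n⇒m%n≡m (ℕ.>-nonZero⁻¹ q))))

  -ᵣ_ : R q → R q
  -ᵣ x = [ q ∸ toℕ x ]

  -- Every residue is [ m ] for some m, so laws of ℕ transfer along [_].
  elim₁ : (P : R q → Set) → (∀ m → P [ m ]) → ∀ x → P x
  elim₁ P h x = subst P ([toℕ] x) (h (toℕ x))

  elim₂ : (P : R q → R q → Set) → (∀ m n → P [ m ] [ n ]) → ∀ x y → P x y
  elim₂ P h x = elim₁ (P x) (λ n → elim₁ (λ x → P x [ n ]) (λ m → h m n) x)

  elim₃ : (P : R q → R q → R q → Set) → (∀ m n o → P [ m ] [ n ] [ o ]) → ∀ x y z → P x y z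
  elim₃ P h x y = elim₁ (P x y) (λ o → elim₂ (λ x y → P x y [ o ]) (λ m n → h m n o) x y)

  open ≡-Reasoning

  +-assoc : ∀ x y z → (x +ᵣ y) +ᵣ z ≡ x +ᵣ (y +ᵣ z)
  +-assoc = elim₃ _ λ m n o → begin
    ([ m ] +ᵣ [ n ]) +ᵣ [ o ] ≡⟨ cong (_+ᵣ [ o ]) ([]-+ m n) ⟩
    [ m + n ] +ᵣ [ o ]        ≡⟨ []-+ (m + n) o ⟩
    [ m + n + o ]             ≡⟨ cong [_] (ℕ.+-assoc m n o) ⟩
    [ m + (n + o) ]           ≡⟨ []-+ m (n + o) ⟨
    [ m ] +ᵣ [ n + o ]        ≡⟨ cong ([ m ] +ᵣ_) ([]-+ n o) ⟨
    [ m ] +ᵣ ([ n ] +ᵣ [ o ]) ∎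

  *-assoc : ∀ x y z → (x *ᵣ y) *ᵣ z ≡ x *ᵣ (y *ᵣ z)
  *-assoc = elim₃ _ λ m n o → begin
    ([ m ] *ᵣ [ n ]) *ᵣ [ o ] ≡⟨ cong (_*ᵣ [ o ]) ([]-* m n) ⟩
    [ m * n ] *ᵣ [ o ]        ≡⟨ []-* (m * n) o ⟩
    [ m * n * o ]             ≡⟨ cong [_] (ℕ.*-assoc m n o) ⟩
    [ m * (n * o) ]           ≡⟨ []-* m (n * o) ⟨
    [ m ] *ᵣ [ n * o ]        ≡⟨ cong ([ m ] *ᵣ_) ([]-* n o) ⟨
    [ m ] *ᵣ ([ n ] *ᵣ [ o ]) ∎

  +-comm : ∀ x y → x +ᵣ y ≡ y +ᵣ x
  +-comm = elim₂ _ λ m n → trans ([]-+ m n) (trans (cong [_] (ℕ.+-comm m n)) (sym ([]-+ n m)))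

  *-comm : ∀ x y → x *ᵣ y ≡ y *ᵣ x
  *-comm = elim₂ _ λ m n → trans ([]-* m n) (trans (cong [_] (ℕ.*-comm m n)) (sym ([]-* n m)))

  +-identityˡ : ∀ x → 0ᵣ +ᵣ x ≡ x
  +-identityˡ = elim₁ _ λ m → []-+ 0 m

  *-identityˡ : ∀ x → 1ᵣ *ᵣ x ≡ x
  *-identityˡ = elim₁ _ λ m → trans ([]-* 1 m) (cong [_] (ℕ.*-identityˡ m))

  distribʳ : ∀ x y z → (y +ᵣ z) *ᵣ x ≡ y *ᵣ x +ᵣ z *ᵣ x
  distribʳ = elim₃ _ λ m n o → begin
    ([ n ] +ᵣ [ o ]) *ᵣ [ m ]       ≡⟨ cong (_*ᵣ [ m ]) ([]-+ n o) ⟩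
    [ n + o ] *ᵣ [ m ]              ≡⟨ []-* (n + o) m ⟩
    [ (n + o) * m ]                 ≡⟨ cong [_] (ℕ.*-distribʳ-+ m n o) ⟩
    [ n * m + o * m ]               ≡⟨ []-+ (n * m) (o * m) ⟨
    [ n * m ] +ᵣ [ o * m ]          ≡⟨ cong₂ _+ᵣ_ ([]-* n m) ([]-* o m) ⟨
    [ n ] *ᵣ [ m ] +ᵣ [ o ] *ᵣ [ m ] ∎

  -‿inverseˡ : ∀ x → (-ᵣ x) +ᵣ x ≡ 0ᵣ
  -‿inverseˡ x = begin
    [ q ∸ toℕ x ] +ᵣ x         ≡⟨ cong ([ q ∸ toℕ x ] +ᵣ_) ([toℕ] x) ⟨
    [ q ∸ toℕ x ] +ᵣ [ toℕ x ] ≡⟨ []-+ (q ∸ toℕ x) (toℕ x) ⟩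
    [ q ∸ toℕ x + toℕ x ]      ≡⟨ cong [_] (ℕ.m∸n+n≡m (toℕ≤n x)) ⟩
    [ q ]                      ≡⟨ [q]≡0 ⟩
    0ᵣ                         ∎

  isCommutativeRing : IsCommutativeRing _≡_ _+ᵣ_ _*ᵣ_ -ᵣ_ 0ᵣ 1ᵣ
  isCommutativeRing = record
    { isRing = record
      { +-isAbelianGroup = record
        { isGroup = record
          { isMonoid = record
            { isSemigroup = record
              { isMagma = record { isEquivalence = isEquivalence ; ∙-cong = cong₂ _+ᵣ_ }
              ; assoc = +-assoc }
            ; identity = comm∧idˡ⇒id +-comm +-identityˡ }
          ; inverse = comm∧invˡ⇒inv +-comm -‿inverseˡ
          ; ⁻¹-cong = cong -ᵣ_ }
        ; comm = +-comm }
      ; *-cong = cong₂ _*ᵣ_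
      ; *-assoc = *-assoc
      ; *-identity = comm∧idˡ⇒id *-comm *-identityˡ
      ; distrib = comm∧distrʳ⇒distrˡ *-comm distribʳ , distribʳ }
    ; *-comm = *-comm }

  ℤ/q : CommutativeRing 0ℓ 0ℓ
  ℤ/q = record { isCommutativeRing = isCommutativeRing }

module PrimePowerModulus (p s : ℕ) (p-prime : Prime p) (1≤s : 1 ≤ s) .{{_ : NonZero (p ^ s)}} where
  open import Defs
  import Algebra.Properties.Ring as RingProperties
  import Algebra.Properties.CommutativeSemigroup as CommSemigroupProperties
  open import Data.Nat as ℕ using (ℕ; zero; suc; _+_; _*_; _∸_; _^_; _<_; _≤_; NonZero)
  import Data.Nat.Properties as ℕ
  open import Data.Nat.Divisibility as ℕ using (divides; _∣?_)
  open import Data.Nat.Coprimality using (Coprime; coprime-Bézout; coprime-divisor)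
  open import Data.Nat.GCD using (module Bézout)
  open import Data.Nat.Induction using (<-wellFounded)
  open import Data.Nat.Primality using (Prime; prime⇒irreducible; prime⇒nonZero; prime⇒nonTrivial)
  open import Data.Nat.DivMod using ([m+kn]%n≡m%n)
  open import Data.Fin as Fin using (Fin; toℕ)
  open import Data.Fin.Properties using (toℕ<n)
  open import Data.Product using (∃; ∃₂; _×_; _,_)
  open import Data.Sum using (_⊎_; inj₁; inj₂)
  import Data.Sum
  open import Induction.WellFounded using (Acc; acc)
  open import Relation.Nullary using (¬_; yes; no; contradiction)
  open import Relation.Binary.PropositionalEquality hiding ([_])

  q : ℕ
  q = p ^ s

  open IntegersModulo q

  open CommutativeRing ℤ/q
    using (*-rawMagma; zeroˡ; *-commutativeSemigroup; +-group; *-identityʳ)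
    renaming (*-comm to *ᵣ-comm)
  open RingProperties (CommutativeRing.ring ℤ/q) using (-‿distribˡ-*)
  open CommSemigroupProperties *-commutativeSemigroup using (x∙yz≈y∙xz)
  open import Algebra.Properties.Group +-group using (inverseˡ-unique; ⁻¹-involutive)
  open import Algebra.Definitions.RawMagma *-rawMagma using (_∣_; _,_)
  open import Algebra.Properties.Semigroup.Divisibility (CommutativeRing.*-semigroup ℤ/q) using (∣ʳ-trans)

  instance
    p≢0 : NonZero p
    p≢0 = prime⇒nonZero p-prime

  1<p : 1 < p
  1<p = ℕ.nonTrivial⇒n>1 p {{prime⇒nonTrivial p-prime}}

  p-factorisation : ∀ m → m ≢ 0 → Acc _<_ m → ∃₂ λ e u → ¬ (p ℕ.∣ u) × m ≡ p ^ e * u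
  p-factorisation m m≢0 (acc smaller) with p ∣? m
  ... | no p∤m = 0 , m , p∤m , sym (ℕ.*-identityˡ m)
  ... | yes (divides c refl) with p-factorisation c c≢0 (smaller (ℕ.m<m*n c p {{ℕ.≢-nonZero c≢0}} 1<p))
    where
      c≢0 : c ≢ 0
      c≢0 refl = m≢0 refl
  ...   | e , u , p∤u , refl = suc e , u , p∤u , trans (ℕ.*-comm (p ^ e * u) p) (sym (ℕ.*-assoc p (p ^ e) u))

  p∤⇒coprime-p^ : ∀ {u} → ¬ (p ℕ.∣ u) → ∀ k → Coprime u (p ^ k)
  p∤⇒coprime-p^ p∤u zero (_ , d∣1) = ℕ.∣1⇒≡1 d∣1
  p∤⇒coprime-p^ {u} p∤u (suc k) {d} (d∣u , d∣p*p^k) =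
    p∤⇒coprime-p^ p∤u k (d∣u , coprime-divisor d⊥p d∣p*p^k)
    where
      d⊥p : Coprime d p
      d⊥p (c∣d , c∣p) with prime⇒irreducible p-prime c∣p
      ... | inj₁ c≡1 = c≡1
      ... | inj₂ refl = contradiction (ℕ.∣-trans c∣d d∣u) p∤u

  exponent<s : ∀ {m e u} → m < q → m ≡ u * p ^ e → u ≢ 0 → e < s
  exponent<s {m} {e} {u} m<q m≡ u≢0 = ℕ.≰⇒> λ s≤e → ℕ.<⇒≱ m<q (begin
    p ^ s     ≤⟨ ℕ.^-monoʳ-≤ p s≤e ⟩
    p ^ e     ≤⟨ ℕ.m≤n*m (p ^ e) u {{ℕ.≢-nonZero u≢0}} ⟩
    u * p ^ e ≡⟨ m≡ ⟨
    m         ∎)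
    where open ℕ.≤-Reasoning

  open ≡-Reasoning

  p∤⇒unit : ∀ {u} → ¬ (p ℕ.∣ u) → ∃ λ v → v *ᵣ [ u ] ≡ 1ᵣ
  p∤⇒unit {u} p∤u with coprime-Bézout (p∤⇒coprime-p^ p∤u s)
  ... | Bézout.+- x y 1+yq≡xu = [ x ] , (begin
    [ x ] *ᵣ [ u ] ≡⟨ []-* x u ⟩
    [ x * u ]      ≡⟨ cong [_] 1+yq≡xu ⟨
    [ 1 + y * q ]  ≡⟨ []-cong-% ([m+kn]%n≡m%n 1 y q) ⟩
    1ᵣ             ∎)
  ... | Bézout.-+ x y 1+xu≡yq = -ᵣ [ x ] , (begin
    (-ᵣ [ x ]) *ᵣ [ u ]  ≡⟨ -‿distribˡ-* [ x ] [ u ] ⟨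
    -ᵣ ([ x ] *ᵣ [ u ])  ≡⟨ cong -ᵣ_ xu≡-1 ⟩
    -ᵣ (-ᵣ 1ᵣ)           ≡⟨ ⁻¹-involutive 1ᵣ ⟩
    1ᵣ                   ∎)
    where
      xu+1≡0 : [ x ] *ᵣ [ u ] +ᵣ 1ᵣ ≡ 0ᵣ
      xu+1≡0 = begin
        [ x ] *ᵣ [ u ] +ᵣ 1ᵣ ≡⟨ cong (_+ᵣ 1ᵣ) ([]-* x u) ⟩
        [ x * u ] +ᵣ [ 1 ]   ≡⟨ []-+ (x * u) 1 ⟩
        [ x * u + 1 ]        ≡⟨ cong [_] (trans (ℕ.+-comm (x * u) 1) 1+xu≡yq) ⟩
        [ 0 + y * q ]        ≡⟨ []-cong-% ([m+kn]%n≡m%n 0 y q) ⟩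
        0ᵣ                   ∎
      xu≡-1 : [ x ] *ᵣ [ u ] ≡ -ᵣ 1ᵣ
      xu≡-1 = inverseˡ-unique _ _ xu+1≡0

  [p^]-∣ : ∀ {e f} → e ≤ f → [ p ^ e ] ∣ [ p ^ f ]
  [p^]-∣ {e} {f} e≤f = [ p ^ (f ∸ e) ] , (begin
    [ p ^ (f ∸ e) ] *ᵣ [ p ^ e ] ≡⟨ []-* (p ^ (f ∸ e)) (p ^ e) ⟩
    [ p ^ (f ∸ e) * p ^ e ]      ≡⟨ cong [_] (ℕ.^-distribˡ-+-* p (f ∸ e) e) ⟨
    [ p ^ (f ∸ e + e) ]          ≡⟨ cong (λ k → [ p ^ k ]) (ℕ.m∸n+n≡m e≤f) ⟩
    [ p ^ f ]                    ∎)

  associated-power : ∀ x → x ≢ 0ᵣ → ∃ λ e → e < s × x ∣ [ p ^ e ] × [ p ^ e ] ∣ x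
  associated-power x x≢0 with p-factorisation (toℕ x) x≢0ℕ (<-wellFounded (toℕ x))
    where
      x≢0ℕ : toℕ x ≢ 0
      x≢0ℕ x≡0 = x≢0 (trans (sym ([toℕ] x)) (cong [_] x≡0))
  ... | e , u , p∤u , x≡p^eu with p∤⇒unit p∤u
  ...   | v , vu≡1 = e , e<s , (v , v*x≡p^e) , ([ u ] , u*p^e≡x)
    where
      x≡ : x ≡ [ p ^ e ] *ᵣ [ u ]
      x≡ = trans (sym ([toℕ] x)) (trans (cong [_] x≡p^eu) (sym ([]-* (p ^ e) u)))
      v*x≡p^e : v *ᵣ x ≡ [ p ^ e ]
      v*x≡p^e = begin
        v *ᵣ x                    ≡⟨ cong (v *ᵣ_) x≡ ⟩
        v *ᵣ ([ p ^ e ] *ᵣ [ u ]) ≡⟨ x∙yz≈y∙xz v [ p ^ e ] [ u ] ⟩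
        [ p ^ e ] *ᵣ (v *ᵣ [ u ]) ≡⟨ cong ([ p ^ e ] *ᵣ_) vu≡1 ⟩
        [ p ^ e ] *ᵣ 1ᵣ           ≡⟨ *-identityʳ [ p ^ e ] ⟩
        [ p ^ e ]                 ∎
      u*p^e≡x : [ u ] *ᵣ [ p ^ e ] ≡ x
      u*p^e≡x = trans (*ᵣ-comm [ u ] [ p ^ e ]) (sym x≡)
      e<s : e < s
      e<s = exponent<s {u = u} (toℕ<n x) (trans x≡p^eu (ℕ.*-comm (p ^ e) u)) (λ { refl → p∤u (p ℕ.∣0) })

  ∣-through-powers : ∀ {x y e f} → x ∣ [ p ^ e ] → e ≤ f → [ p ^ f ] ∣ y → x ∣ y
  ∣-through-powers {x} {y} {e} {f} x∣p^e e≤f p^f∣y =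
    ∣ʳ-trans {x} {[ p ^ e ]} {y} x∣p^e (∣ʳ-trans {[ p ^ e ]} {[ p ^ f ]} {y} ([p^]-∣ {e} {f} e≤f) p^f∣y)

  ∣-total : ∀ x y → x ∣ y ⊎ y ∣ x
  ∣-total x y with x Fin.≟ 0ᵣ | y Fin.≟ 0ᵣ
  ... | yes x≡0 | _ = inj₂ (0ᵣ , trans (zeroˡ y) (sym x≡0))
  ... | no _ | yes y≡0 = inj₁ (0ᵣ , trans (zeroˡ x) (sym y≡0))
  ... | no x≢0 | no y≢0 =
    let (e , _ , x∣p^e , p^e∣x) = associated-power x x≢0
        (f , _ , y∣p^f , p^f∣y) = associated-power y y≢0
    in Data.Sum.map (λ e≤f → ∣-through-powers x∣p^e e≤f p^f∣y) (λ f≤e → ∣-through-powers y∣p^f f≤e p^e∣x)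
                    (ℕ.≤-total e f)

  socle : R q
  socle = [ p ^ ℕ.pred s ]

  pred[s]<s : ℕ.pred s < s
  pred[s]<s = ℕ.m≤pred[n]⇒suc[m]≤n {{ℕ.>-nonZero 1≤s}} ℕ.≤-refl

  socle≢0 : socle ≢ 0ᵣ
  socle≢0 socle≡0 = ℕ.≢-nonZero⁻¹ (p ^ ℕ.pred s) {{ℕ.m^n≢0 p (ℕ.pred s)}}
    ([]-injective (ℕ.^-monoʳ-< p 1<p pred[s]<s) (ℕ.>-nonZero⁻¹ q) socle≡0)

  ∣socle : ∀ {x} → x ≢ 0ᵣ → x ∣ socle
  ∣socle {x} x≢0 = let (e , e<s , x∣p^e , _) = associated-power x x≢0 in
    ∣-through-powers x∣p^e (ℕ.suc[m]≤n⇒m≤pred[n] e<s) (1ᵣ , *-identityˡ socle)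

  chainRing : ChainRing
  chainRing = record
    { isCommutativeRing = isCommutativeRing
    ; _≟_ = Fin._≟_
    ; ∣-total = ∣-total
    ; socle = socle
    ; socle≢0 = socle≢0
    ; ∣socle = ∣socle }

module VecMatrices (q : ℕ) .{{_ : NonZero q}} where
  open import Defs
  open import Data.Fin as Fin using (Fin; zero; suc; _↑ˡ_; _↑ʳ_)
  import Data.Fin.Properties as Fin
  open import Data.Nat as ℕ using (ℕ; NonZero)
  open import Data.Product using (Σ; ∃; _,_; proj₁; proj₂)
  open import Data.Sum using (inj₁; inj₂)
  open import Data.Vec as Vec using (Vec; lookup; tabulate)
  import Data.Vec.Properties as Vec
  open import Data.Vec.Relation.Binary.Pointwise.Extensional using (ext; Pointwise-≡⇒≡)
  import Data.Vec.Functional as Vector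
  import Function
  open import Function using (_∘_)
  open import Function.Bundles using (_⇔_; mk⇔)
  open import Relation.Nullary.Decidable using (isYes≗does)
  open import Relation.Binary.PropositionalEquality hiding ([_])

  open IntegersModulo q
  open CommutativeRing ℤ/q using (+-identityʳ)
  open Matrices ℤ/q

  private variable k m n : ℕ

  toMatrix : Mat q m n → Matrix m n
  toMatrix M i j = lookup (lookup M i) j

  fromMatrix : Matrix m n → Mat q m n
  fromMatrix X = tabulate λ i → tabulate (X i)

  toMatrix-fromMatrix : (X : Matrix m n) → toMatrix (fromMatrix X) ≈ₘ X
  toMatrix-fromMatrix X i j = trans (cong (λ row → lookup row j) (Vec.lookup∘tabulate _ i)) (Vec.lookup∘tabulate (X i) j)

  toMatrix-injective : {M N : Mat q m n} → toMatrix M ≈ₘ toMatrix N → M ≡ N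
  toMatrix-injective M≈N = Pointwise-≡⇒≡ (ext λ i → Pointwise-≡⇒≡ (ext (M≈N i)))

  Σᵣ≡sum : (f : Fin n → R q) → Σᵣ f ≡ sum f
  Σᵣ≡sum {ℕ.zero} f = refl
  Σᵣ≡sum {ℕ.suc n} f = cong (f zero +ᵣ_) (Σᵣ≡sum (f ∘ suc))

  toMatrix-⊗ : (M : Mat q m k) (N : Mat q k n) → toMatrix (M ⊗ N) ≈ₘ toMatrix M ⊙ toMatrix N
  toMatrix-⊗ M N i j = trans (toMatrix-fromMatrix _ i j) (Σᵣ≡sum λ l → toMatrix M i l *ᵣ toMatrix N l j)

  toMatrix-idMat : toMatrix (idMat {k = n}) ≈ₘ I
  toMatrix-idMat i j = trans (toMatrix-fromMatrix _ i j) (cong (λ b → if b then 1ᵣ else 0ᵣ) (isYes≗does (i Fin.≟ j)))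
    where open import Data.Bool using (if_then_else_)

  unimodular⇒hasRightInverse : (M : Mat q m n) → Unimodular M → HasRightInverse (toMatrix M)
  unimodular⇒hasRightInverse M (N , M⊗N≡id) = toMatrix N , λ i j →
    trans (sym (toMatrix-⊗ M N i j)) (trans (cong (λ X → toMatrix X i j) M⊗N≡id) (toMatrix-idMat i j))

  hasRightInverse⇒unimodular : (M : Mat q m n) → HasRightInverse (toMatrix M) → Unimodular M
  hasRightInverse⇒unimodular M (N , MN≈I) = fromMatrix N , toMatrix-injective λ i j → begin
    toMatrix (M ⊗ fromMatrix N) i j       ≡⟨ toMatrix-⊗ M (fromMatrix N) i j ⟩
    (toMatrix M ⊙ toMatrix (fromMatrix N)) i j ≡⟨ ⊙-congˡ (toMatrix M) (toMatrix-fromMatrix N) i j ⟩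
    (toMatrix M ⊙ N) i j                  ≡⟨ MN≈I i j ⟩
    I i j                                 ≡⟨ toMatrix-idMat i j ⟨
    toMatrix idMat i j                    ∎
    where open ≡-Reasoning

  rowVector : (Fin k → R q) → Matrix 1 k
  rowVector c _ = c

  InRowSpace : Matrix k n → (Fin n → R q) → Set
  InRowSpace X v = ∃ λ c → ∀ j → v j ≡ (rowVector c ⊙ X) zero j

  lookup-comb : (c : RVec q k) (M : Mat q k n) → ∀ j → lookup (comb c M) j ≡ (rowVector (lookup c) ⊙ toMatrix M) zero j
  lookup-comb c M j = trans (Vec.lookup∘tabulate _ j) (Σᵣ≡sum λ i → lookup c i *ᵣ toMatrix M i j)

  rowSpan⇒inRowSpace : (M : Mat q k n) {v : RVec q n} → RowSpan M v → InRowSpace (toMatrix M) (lookup v)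
  rowSpan⇒inRowSpace M (c , refl) = lookup c , lookup-comb c M

  inRowSpace⇒rowSpan : (M : Mat q k n) {v : RVec q n} → InRowSpace (toMatrix M) (lookup v) → RowSpan M v
  inRowSpace⇒rowSpan M {v} (c , v≡cM) = tabulate c , Pointwise-≡⇒≡ (ext λ j → begin
    lookup v j                                       ≡⟨ v≡cM j ⟩
    (rowVector c ⊙ toMatrix M) zero j                ≡⟨ ⊙-congʳ {X = rowVector c} (toMatrix M) (λ _ l → sym (Vec.lookup∘tabulate c l)) zero j ⟩
    (rowVector (lookup (tabulate c)) ⊙ toMatrix M) zero j ≡⟨ lookup-comb (tabulate c) M j ⟨
    lookup (comb (tabulate c) M) j                   ∎)
    where open ≡-Reasoning

  inRowSpace-⊙ : {X : Matrix k m} {Y : Matrix m n} {v : Fin n → R q} → InRowSpace (X ⊙ Y) v → InRowSpace Y v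
  inRowSpace-⊙ {X = X} {Y} (c , v≡cXY) = (rowVector c ⊙ X) zero , λ j → trans (v≡cXY j) (sym (⊙-assoc (rowVector c) X Y zero j))

  rowSpan-⊆ : (K : Mat q k n) (M : Mat q m n) (C : Matrix k m) → toMatrix K ≈ₘ C ⊙ toMatrix M → RowSpan K ⊆ RowSpan M
  rowSpan-⊆ K M C K≈CM v v∈K =
    let (c , v≡cK) = rowSpan⇒inRowSpace K v∈K in
    inRowSpace⇒rowSpan M (inRowSpace-⊙ {X = C} (c , λ j → trans (v≡cK j) (⊙-congˡ (rowVector c) K≈CM zero j)))

  rows⇒factorisation : (K : Mat q k n) (M : Mat q m n) → AllRowsIn K (RowSpan M) → Σ (Matrix k m) λ C → toMatrix K ≈ₘ C ⊙ toMatrix M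
  rows⇒factorisation K M rows = (λ i → proj₁ (coefficients i)) , λ i → proj₂ (coefficients i)
    where coefficients = λ i → rowSpan⇒inRowSpace M (rows i)

  row∈rowSpan : (M : Mat q k n) → AllRowsIn M (RowSpan M)
  row∈rowSpan M i = inRowSpace⇒rowSpan M (δ i , λ j → sym (⊙-identityˡ (toMatrix M) i j))

  rowSpan-isLinear : (M : Mat q k n) → IsLinear (RowSpan M)
  rowSpan-isLinear M = zero∈ , +∈ , ·∈
    where
      X = toMatrix M
      zero∈ : RowSpan M zeroVec
      zero∈ = inRowSpace⇒rowSpan M ((λ _ → 0ᵣ) , λ j → trans (Vec.lookup-replicate j 0ᵣ) (sym (⊙-zeroˡ {m = 1} X zero j)))
      +∈ : ∀ u v → RowSpan M u → RowSpan M v → RowSpan M (u +ᵥ v)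
      +∈ u v u∈ v∈ =
        let (c , u≡cX) = rowSpan⇒inRowSpace M u∈ ; (d , v≡dX) = rowSpan⇒inRowSpace M v∈ in
        inRowSpace⇒rowSpan M ((λ i → c i +ᵣ d i) , λ j →
          trans (Vec.lookup∘tabulate _ j) (trans (cong₂ _+ᵣ_ (u≡cX j) (v≡dX j)) (sym (⊙-distribʳ-⊞ (rowVector c) (rowVector d) X zero j))))
      ·∈ : ∀ r v → RowSpan M v → RowSpan M (r ·ᵥ v)
      ·∈ r v v∈ =
        let (c , v≡cX) = rowSpan⇒inRowSpace M v∈ in
        inRowSpace⇒rowSpan M ((λ i → r *ᵣ c i) , λ j →
          trans (Vec.lookup∘tabulate _ j) (trans (cong (r *ᵣ_) (v≡cX j)) (sym (⋆-⊙ r (rowVector c) X zero j))))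

  -- a right inverse N recovers the coefficients of a combination: c = c M N
  comb-injective : (M : Mat q k n) → Unimodular M → ∀ c → comb c M ≡ zeroVec → c ≡ zeroVec
  comb-injective M M-unimodular c cM≡0 = Pointwise-≡⇒≡ (ext λ l → begin
    lookup c l                               ≡⟨ ⊙-identityʳ (rowVector (lookup c)) zero l ⟨
    (rowVector (lookup c) ⊙ I) zero l        ≡⟨ ⊙-congˡ (rowVector (lookup c)) MN≈I zero l ⟨
    (rowVector (lookup c) ⊙ (X ⊙ N)) zero l  ≡⟨ ⊙-assoc (rowVector (lookup c)) X N zero l ⟨
    (rowVector (lookup c) ⊙ X ⊙ N) zero l    ≡⟨ ⊙-zero-row (rowVector (lookup c) ⊙ X) N {zero} cM≈0 l ⟩
    0ᵣ                                       ≡⟨ Vec.lookup-replicate l 0ᵣ ⟨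
    lookup zeroVec l                         ∎)
    where
      open ≡-Reasoning
      X = toMatrix M
      N = proj₁ (unimodular⇒hasRightInverse M M-unimodular)
      MN≈I = proj₂ (unimodular⇒hasRightInverse M M-unimodular)
      cM≈0 : ∀ j → (rowVector (lookup c) ⊙ X) zero j ≡ 0ᵣ
      cM≈0 j = trans (sym (lookup-comb c M j)) (trans (cong (λ v → lookup v j) cM≡0) (Vec.lookup-replicate j 0ᵣ))

  rowSpan-isSubspace : (M : Mat q k n) → Unimodular M → IsSubspace k (RowSpan M)
  rowSpan-isSubspace M M-unimodular =
    rowSpan-isLinear M , M , M-unimodular , (λ v → mk⇔ Function.id Function.id) , comb-injective M M-unimodular

  toMatrix-++ : ∀ {a b} (A : Mat q a n) (B : Mat q b n) → toMatrix (A Vec.++ B) ≈ₘ toMatrix A Vector.++ toMatrix B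
  toMatrix-++ {a = a} A B i j with Fin.splitAt a i in split
  ... | inj₁ i′ rewrite sym (Fin.splitAt⁻¹-↑ˡ split) = cong (λ row → lookup row j) (Vec.lookup-++ˡ A B i′)
  ... | inj₂ i′ rewrite sym (Fin.splitAt⁻¹-↑ʳ split) = cong (λ row → lookup row j) (Vec.lookup-++ʳ A B i′)

module SubspacesOfPrimePowerModulus (p s : ℕ) (p-prime : Prime p) (1≤s : 1 ≤ s) .{{_ : NonZero (p ^ s)}} where
  open import Defs
  import Data.Fin as Fin
  open import Data.Nat using (ℕ; _+_; _∸_; _≤_)
  open import Data.Product using (_,_; proj₁; proj₂)
  open import Data.Sum using (inj₁; inj₂)
  open import Data.Vec using (_++_; lookup)
  import Data.Vec.Functional as Vector
  open import Function using (_∘_)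
  open import Function.Bundles using (Equivalence)
  open import Relation.Binary.PropositionalEquality hiding ([_])

  open PrimePowerModulus p s p-prime 1≤s using (q; chainRing)
  open IntegersModulo q using (ℤ/q)
  open Matrices ℤ/q
  open VecMatrices q
  open MatrixRank chainRing using (right-invertible-factor-≤)

  private variable k n : ℕ

  fromMatrix-hasRightInverse : (K : Matrix k n) → HasRightInverse K → Unimodular (fromMatrix K)
  fromMatrix-hasRightInverse K (N , KN≈I) =
    hasRightInverse⇒unimodular (fromMatrix K) (N , ≈ₘ-trans (⊙-congʳ N (toMatrix-fromMatrix K)) KN≈I)

  unimodular⇒hasDim : (M : Mat q k n) → Unimodular M → HasDim (RowSpan M) k
  unimodular⇒hasDim M M-unimodular = (M , M-unimodular , row∈rowSpan M) , λ k′ K K-unimodular K⊆M →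
    let (C , K≈CM) = rows⇒factorisation K M K⊆M in
    right-invertible-factor-≤ (toMatrix K) C (toMatrix M) (unimodular⇒hasRightInverse K K-unimodular) K≈CM

  module Stacked {a b n : ℕ} (A : Mat q a n) (B : Mat q b n) where

    open JoinAndMeet chainRing (toMatrix A) (toMatrix B) public using (rank; rank≤rows)
    open JoinAndMeet chainRing (toMatrix A) (toMatrix B)
      using (JoinBasis; MeetBasis; rank-factorisation; rank-≤-factorisation; join-basis; meet-basis; meet-bound)

    joinDim : JoinDim (RowSpan A) (RowSpan B) rank
    joinDim =
      (RowSpan (fromMatrix K) , rowSpan-isSubspace (fromMatrix K) (fromMatrix-hasRightInverse K K-invertible) ,
       rowSpan-⊆ A (fromMatrix K) Gᴬ (through Gᴬ A≈GᴬK) , rowSpan-⊆ B (fromMatrix K) Gᴮ (through Gᴮ B≈GᴮK)) ,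
      minimal
      where
        open JoinBasis join-basis
        through : ∀ {m} {X : Matrix m n} (G : Matrix m rank) → X ≈ₘ G ⊙ K → X ≈ₘ G ⊙ toMatrix (fromMatrix K)
        through G X≈GK = ≈ₘ-trans X≈GK (⊙-congˡ G (≈ₘ-sym (toMatrix-fromMatrix K)))
        minimal : ∀ k V → IsSubspace k V → RowSpan A ⊆ V → RowSpan B ⊆ V → rank ≤ k
        minimal k V (_ , W , _ , V⇔W , _) A⊆V B⊆V =
          rank-≤-factorisation (λ i → proj₁ (row∈W i)) (toMatrix W) (λ i → proj₂ (row∈W i))
          where
            V⇒W : ∀ {v} → V v → InRowSpace (toMatrix W) (lookup v)
            V⇒W v∈V = rowSpan⇒inRowSpace W (Equivalence.to (V⇔W _) v∈V)
            row∈W : ∀ i → InRowSpace (toMatrix W) ((toMatrix A Vector.++ toMatrix B) i)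
            row∈W i with Fin.splitAt a i
            ... | inj₁ i′ = V⇒W (A⊆V _ (row∈rowSpan A i′))
            ... | inj₂ i′ = V⇒W (B⊆V _ (row∈rowSpan B i′))

    meetDim : Unimodular A → Unimodular B → HasDim (RowSpan A ∩ RowSpan B) (a + b ∸ rank)
    meetDim A-unimodular B-unimodular = (fromMatrix K , fromMatrix-hasRightInverse K K-invertible , rows∈A∩B) , maximal
      where
        open MeetBasis (meet-basis (unimodular⇒hasRightInverse A A-unimodular) (unimodular⇒hasRightInverse B B-unimodular))
        through : ∀ {m} {X : Matrix m n} (C : Matrix _ m) → K ≈ₘ C ⊙ X → toMatrix (fromMatrix K) ≈ₘ C ⊙ X
        through C K≈CX = ≈ₘ-trans (toMatrix-fromMatrix K) K≈CX
        rows∈A∩B : AllRowsIn (fromMatrix K) (RowSpan A ∩ RowSpan B)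
        rows∈A∩B i = rowSpan-⊆ (fromMatrix K) A Cᴬ (through Cᴬ K≈CᴬA) _ (row∈rowSpan (fromMatrix K) i)
                   , rowSpan-⊆ (fromMatrix K) B Cᴮ (through Cᴮ K≈CᴮB) _ (row∈rowSpan (fromMatrix K) i)
        maximal : ∀ k (K′ : Mat q k n) → Unimodular K′ → AllRowsIn K′ (RowSpan A ∩ RowSpan B) → k ≤ a + b ∸ rank
        maximal k K′ K′-unimodular rows∈A∩B′ =
          let (C , K′≈CA) = rows⇒factorisation K′ A (proj₁ ∘ rows∈A∩B′)
              (E , K′≈EB) = rows⇒factorisation K′ B (proj₂ ∘ rows∈A∩B′)
          in meet-bound (toMatrix K′) C E (unimodular⇒hasRightInverse K′ K′-unimodular) K′≈CA K′≈EB

    innerRank : HasInnerRank (A ++ B) rank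
    innerRank = (fromMatrix G , fromMatrix K , toMatrix-injective GK≈A++B) , minimal
      where
        G = proj₁ rank-factorisation
        K = proj₁ (proj₂ rank-factorisation)
        A++B≈GK = proj₁ (proj₂ (proj₂ rank-factorisation))
        GK≈A++B : toMatrix (fromMatrix G ⊗ fromMatrix K) ≈ₘ toMatrix (A ++ B)
        GK≈A++B = ≈ₘ-trans (toMatrix-⊗ (fromMatrix G) (fromMatrix K))
                   (≈ₘ-trans (⊙-cong (toMatrix-fromMatrix G) (toMatrix-fromMatrix K))
                   (≈ₘ-trans (≈ₘ-sym A++B≈GK) (≈ₘ-sym (toMatrix-++ A B))))
        minimal : ∀ r′ (C : Mat q (a + b) r′) (D : Mat q r′ n) → C ⊗ D ≡ A ++ B → rank ≤ r′
        minimal r′ C D C⊗D≡A++B = rank-≤-factorisation (toMatrix C) (toMatrix D)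
          (≈ₘ-trans (≈ₘ-sym (toMatrix-++ A B))
          (≈ₘ-trans (λ i j → cong (λ M → toMatrix M i j) (sym C⊗D≡A++B)) (toMatrix-⊗ C D)))

open import Defs
open import Data.Nat using (_+_; _∸_)
open import Data.Nat.Properties using (m+[n∸m]≡n)
open import Data.Vec using (_++_)
open import Data.Product using (Σ; _×_; _,_)
open import Relation.Binary.PropositionalEquality using (refl)

theorem3p2 : (p s : ℕ) → Prime p → 1 ≤ s → .{{_ : NonZero (p ^ s)}} →
    (n a b : ℕ) (A : Mat (p ^ s) a n) (B : Mat (p ^ s) b n) →
    Unimodular A → Unimodular B →
    Σ ℕ λ dJ → Σ ℕ λ dA → Σ ℕ λ dB → Σ ℕ λ dI → Σ ℕ λ r →
      JoinDim (RowSpan A) (RowSpan B) dJ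
      × HasDim (RowSpan A) dA
      × HasDim (RowSpan B) dB
      × HasDim (RowSpan A ∩ RowSpan B) dI
      × HasInnerRank (A ++ B) r
      × dJ + dI ≡ dA + dB
      × dJ ≡ r
theorem3p2 p s p-prime 1≤s n a b A B A-unimodular B-unimodular =
  rank , a , b , a + b ∸ rank , rank ,
  joinDim ,
  unimodular⇒hasDim A A-unimodular ,
  unimodular⇒hasDim B B-unimodular ,
  meetDim A-unimodular B-unimodular ,
  innerRank ,
  m+[n∸m]≡n rank≤rows ,
  refl
  where
    open SubspacesOfPrimePowerModulus p s p-prime 1≤s
    open Stacked A B
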